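{- Let $n\ge2$, $k\in\{1,\dots,n-1\}$, and let \[P=\begin{bmatrix} N & R\\ 0 & A\end{bmatrix}\in\{0,1\}^{n\times n}\] be nonsingular, with $N\in\{0,1\}^{k\times k}$, $R\in\{0,1\}^{k\times(n-k)}$, $A\in\{0,1\}^{(n-k)\times(n-k)}$, $A$ fully indecomposable, and such that the simplex $\mathrm{conv}\{0,\text{columns of }P\}\subset\mathbb{R}^n$ is nonobtuse. Then: (i) $\mathrm{conv}\{0,\text{columns of }N\}\subset\mathbb{R}^k$ is a nonobtuse simplex; (ii) $\mathrm{conv}\{0,\text{columns of }A\}\subset\mathbb{R}^{n-k}$ is a nonobtuse simplex; (iii) $R=\nu (e^{n-k})^\top$, where $e^{n-k}$ is the all-ones vector of length $n-k$ and $\nu\in\{0,1\}^k$ is either the zero vector or a column of $N$.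
   Context: The dihedral angle between two facets of a simplex is $\pi$ minus the angle between their inward normals; a simplex is nonobtuse if none of its dihedral angles exceeds $\pi/2$. A matrix $A\in\{0,1\}^{m\times m}$ is partly decomposable if there exist $j\in\{1,\dots,m-1\}$ and permutation matrices $\Pi_1,\Pi_2$ with $\Pi_1^\top A\Pi_2=\begin{bmatrix}A_{11}&A_{12}\\0&A_{22}\end{bmatrix}$, $A_{11}$ of size $j\times j$; otherwise $A$ is fully indecomposable. -}

module Defs where

open import Data.Bool using (Bool; true; false)
open import Data.Nat as ℕ using (ℕ; zero; suc)
open import Data.Fin using (Fin; zero; suc; splitAt; toℕ)
open import Data.Fin.Permutation using (Permutation′; _⟨$⟩ʳ_)
open import Data.Rational using (ℚ; 0ℚ; 1ℚ; _+_; _-_; _*_; _≤_; _<_)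
open import Data.Sum using (_⊎_; inj₁; inj₂)
open import Data.Product using (Σ; ∃; _×_; _,_)
open import Relation.Binary.PropositionalEquality using (_≡_; _≢_)

-- 0/1 matrices with m rows and n columns: entry (row r, column c)
Mat01 : ℕ → ℕ → Set
Mat01 m n = Fin m → Fin n → Bool

Vecℚ : ℕ → Set
Vecℚ n = Fin n → ℚ

toℚ : Bool → ℚ
toℚ true  = 1ℚ
toℚ false = 0ℚ

sumℚ : ∀ {n} → (Fin n → ℚ) → ℚ
sumℚ {zero}  f = 0ℚ
sumℚ {suc n} f = f zero + sumℚ (λ i → f (suc i))

dot : ∀ {n} → Vecℚ n → Vecℚ n → ℚ
dot u v = sumℚ (λ i → u i * v i)

mulVec : ∀ {m n} → Mat01 m n → Vecℚ n → Vecℚ m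
mulVec M x r = sumℚ (λ c → toℚ (M r c) * x c)

Nonsingular : ∀ {n} → Mat01 n n → Set
Nonsingular {n} M = (x : Vecℚ n) → (∀ r → mulVec M x r ≡ 0ℚ) → ∀ c → x c ≡ 0ℚ

-- vertices of conv{0, columns of M}: vertex 0 is the origin, vertex (suc j) is column j
vertex : ∀ {n} → Mat01 n n → Fin (suc n) → Vecℚ n
vertex M zero    r = 0ℚ
vertex M (suc j) r = toℚ (M r j)

_−v_ : ∀ {n} → Vecℚ n → Vecℚ n → Vecℚ n
(u −v v) i = u i - v i

-- u is an inward normal of the facet of conv{0, columns of M} opposite vertex i:
-- u is orthogonal to the facet (all vertices except vertex i) and points towards vertex i.
InwardNormal : ∀ {n} → Mat01 n n → Fin (suc n) → Vecℚ n → Set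
InwardNormal M i u =
  (∀ a b → a ≢ i → b ≢ i → dot u (vertex M a −v vertex M b) ≡ 0ℚ) ×
  (∀ b → b ≢ i → 0ℚ < dot u (vertex M i −v vertex M b))

-- conv{0, columns of M} is a simplex (M nonsingular) and no dihedral angle exceeds π/2,
-- i.e. the angle between inward normals of any two distinct facets is ≥ π/2,
-- i.e. their inner product is ≤ 0.
NonobtuseSimplex : ∀ {n} → Mat01 n n → Set
NonobtuseSimplex {n} M =
  Nonsingular M ×
  (∀ (i j : Fin (suc n)) → i ≢ j → (u w : Vecℚ n) →
     InwardNormal M i u → InwardNormal M j w → dot u w ≤ 0ℚ)

-- Π₁ᵀ A Π₂ = [A₁₁ A₁₂; 0 A₂₂] with A₁₁ of size j×j, 1 ≤ j ≤ m-1.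
-- The (r,c) entry of Π₁ᵀ A Π₂ is A (σ r) (τ c) for permutations σ τ.
PartlyDecomposable : ∀ {m} → Mat01 m m → Set
PartlyDecomposable {m} A =
  Σ ℕ λ j → (1 ℕ.≤ j) × (j ℕ.< m) ×
  Σ (Permutation′ m) λ σ → Σ (Permutation′ m) λ τ →
    ∀ (r c : Fin m) → j ℕ.≤ toℕ r → toℕ c ℕ.< j → A (σ ⟨$⟩ʳ r) (τ ⟨$⟩ʳ c) ≡ false

FullyIndecomposable : ∀ {m} → Mat01 m m → Set
FullyIndecomposable A = PartlyDecomposable A → Data.Empty.⊥
  where import Data.Empty

blockAux : ∀ {k m} → Mat01 k k → Mat01 k m → Mat01 m m →
           Fin k ⊎ Fin m → Fin k ⊎ Fin m → Bool
blockAux N R A (inj₁ i) (inj₁ j) = N i j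
blockAux N R A (inj₁ i) (inj₂ j) = R i j
blockAux N R A (inj₂ i) (inj₁ j) = false
blockAux N R A (inj₂ i) (inj₂ j) = A i j

block : ∀ {k m} → Mat01 k k → Mat01 k m → Mat01 m m → Mat01 (k ℕ.+ m) (k ℕ.+ m)
block {k} N R A r c = blockAux N R A (splitAt k r) (splitAt k c)

-- Let q be the basis dual to the columns of P and s = Σⱼ qⱼ. The qⱼ and - s are inward normals of
-- the facets of conv{0, columns of P}, so nonobtuseness gives qᵢ · qⱼ ≤ 0 for i ≠ j and qᵢ · s ≥ 0.
-- Split column c of [R; A] as (R꜀, 0) + (0, A꜀) and expand (0, A꜀) in the dual basis: the
-- coordinates μ of (R꜀, 0) in the columns of P vanish on the A-block, and on the N-block they are
-- nonnegative with sum at most 1. So the 0/1 vector R꜀ = N μ is 0 or a column of N.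
-- Let C be the set of columns c with R꜀ equal to column a of N. The Gram matrix AᵀA is inverse to
-- the Gram matrix W of the dual vectors of the A-block, which is nonpositive off the diagonal, and
-- AᵀA g = - 1_C for the nonpositive vector g of inner products with the a-th dual vector. This
-- forces AᵀA to vanish between C and its complement: no row of A meets both, so by full
-- indecomposability C is empty or everything, and all columns of R are one vertex ν of the simplex
-- of N.
-- Finally, inward normals of the simplices of N and of A extend to inward normals of the simplex
-- of P with the same pairwise inner products, which gives (i) and (ii).

module Submission where

open import Defs

module NonobtuseBlocks where

  open import Data.Bool as Bool using (Bool; true; false; not; if_then_else_)
  open import Data.Bool.Properties using (not-injective; ¬-not)
  open import Data.Empty using (⊥-elim)
  open import Data.Fin as Fin using (Fin; zero; suc; toℕ; splitAt; punchIn; punchOut; fromℕ<; _↑ˡ_; _↑ʳ_)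
  import Data.Fin.Properties as Finₚ
  open import Data.Fin.Permutation as Perm using (Permutation; Permutation′; _⟨$⟩ʳ_; lift₀; insert; insert-punchIn)
  open import Data.Nat as ℕ using (ℕ; zero; suc; z≤n; s≤s)
  import Data.Nat.Properties as ℕₚ
  open import Algebra.Properties.CommutativeSemigroup ℕₚ.+-commutativeSemigroup using (interchange)
  open import Data.Product using (Σ; ∃; _×_; _,_; proj₁; proj₂)
  open import Data.Rational using (ℚ; 0ℚ; 1ℚ; _+_; _-_; _*_; -_; 1/_; _≤_; _<_; _≟_; ≢-nonZero; nonNegative)
  import Data.Rational.Properties as ℚₚ
  open import Algebra.Properties.Group ℚₚ.+-0-group using (x∙y⁻¹≈ε⇒x≈y; ⁻¹-involutive; inverseʳ-unique)
  open import Data.Rational.Solver using (module +-*-Solver)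
  open import Data.Sum using (_⊎_; inj₁; inj₂)
  open import Data.Vec.Functional using (_++_)
  open import Data.Vec.Functional.Properties using (lookup-++ˡ; lookup-++ʳ; ++-cong)
  open import Function using (_∘_; _$_)
  open import Relation.Nullary using (¬_; Dec; yes; no; does; contradiction)
  open import Relation.Nullary.Decidable using (dec-true; dec-false; ¬?; decidable-stable; _×-dec_)
  open import Relation.Binary.PropositionalEquality

  open +-*-Solver using (solve; _:=_; _:+_; _:*_; :-_; con)

  module ℚ-≤-Reasoning where
    open import Relation.Binary.Reasoning.Base.Triple
      ℚₚ.≤-isPreorder ℚₚ.<-asym ℚₚ.<-trans (resp₂ _<_) ℚₚ.<⇒≤ ℚₚ.<-≤-trans ℚₚ.≤-<-trans
      public

  0≤toℚ : ∀ b → 0ℚ ≤ toℚ b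
  0≤toℚ true  = ℚₚ.<⇒≤ (ℚₚ.positive⁻¹ 1ℚ)
  0≤toℚ false = ℚₚ.≤-refl

  toℚ-injective : ∀ {b c} → toℚ b ≡ toℚ c → b ≡ c
  toℚ-injective {true}  {true}  _ = refl
  toℚ-injective {false} {false} _ = refl
  toℚ-injective {true}  {false} ()
  toℚ-injective {false} {true}  ()

  *-nonNeg : ∀ {a b} → 0ℚ ≤ a → 0ℚ ≤ b → 0ℚ ≤ a * b
  *-nonNeg {a} {b} 0≤a 0≤b =
    ℚₚ.nonNegative⁻¹ _ {{ℚₚ.nonNeg*nonNeg⇒nonNeg a {{nonNegative 0≤a}} b {{nonNegative 0≤b}}}}

  *-nonNeg-nonPos : ∀ {a b} → 0ℚ ≤ a → b ≤ 0ℚ → a * b ≤ 0ℚ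
  *-nonNeg-nonPos {a} {b} 0≤a b≤0 = begin
    a * b   ≤⟨ ℚₚ.*-monoˡ-≤-nonNeg a {{nonNegative 0≤a}} b≤0 ⟩
    a * 0ℚ  ≡⟨ ℚₚ.*-zeroʳ a ⟩
    0ℚ      ∎
    where open ℚ-≤-Reasoning

  0≤x⇒y-x≤y : ∀ {x} y → 0ℚ ≤ x → y - x ≤ y
  0≤x⇒y-x≤y {x} y 0≤x = begin
    y - x   ≤⟨ ℚₚ.+-monoʳ-≤ y (ℚₚ.neg-antimono-≤ 0≤x) ⟩
    y + 0ℚ  ≡⟨ ℚₚ.+-identityʳ y ⟩
    y       ∎
    where open ℚ-≤-Reasoning

  x<y⇒0<y-x : ∀ {x y} → x < y → 0ℚ < y - x
  x<y⇒0<y-x {x} {y} x<y = begin-strict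
    0ℚ      ≡⟨ ℚₚ.+-inverseʳ x ⟨
    x - x   <⟨ ℚₚ.+-monoˡ-< (- x) x<y ⟩
    y - x   ∎
    where open ℚ-≤-Reasoning

  0<y-x⇒x<y : ∀ {x y} → 0ℚ < y - x → x < y
  0<y-x⇒x<y {x} {y} 0<y-x = begin-strict
    x             ≡⟨ ℚₚ.+-identityˡ x ⟨
    0ℚ + x        <⟨ ℚₚ.+-monoˡ-< x 0<y-x ⟩
    (y - x) + x   ≡⟨ solve 2 (λ x y → (y :+ :- x) :+ x := y) refl x y ⟩
    y             ∎
    where open ℚ-≤-Reasoning

  sum-cong : ∀ {n} {f g : Fin n → ℚ} → (∀ i → f i ≡ g i) → sumℚ f ≡ sumℚ g
  sum-cong {zero}  f≗g = refl
  sum-cong {suc n} f≗g = cong₂ _+_ (f≗g zero) (sum-cong (f≗g ∘ suc))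

  sum-zero : ∀ {n} {f : Fin n → ℚ} → (∀ i → f i ≡ 0ℚ) → sumℚ f ≡ 0ℚ
  sum-zero {zero}  f≗0 = refl
  sum-zero {suc n} f≗0 = cong₂ _+_ (f≗0 zero) (sum-zero (f≗0 ∘ suc))

  sum-distrib-+ : ∀ {n} (f g : Fin n → ℚ) → sumℚ (λ i → f i + g i) ≡ sumℚ f + sumℚ g
  sum-distrib-+ {zero}  f g = refl
  sum-distrib-+ {suc n} f g = begin
    (f zero + g zero) + sumℚ (λ i → f (suc i) + g (suc i))
      ≡⟨ cong ((f zero + g zero) +_) (sum-distrib-+ (f ∘ suc) (g ∘ suc)) ⟩
    (f zero + g zero) + (sumℚ (f ∘ suc) + sumℚ (g ∘ suc))
      ≡⟨ solve 4 (λ a b c d → (a :+ b) :+ (c :+ d) := (a :+ c) :+ (b :+ d))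
               refl (f zero) (g zero) (sumℚ (f ∘ suc)) (sumℚ (g ∘ suc)) ⟩
    (f zero + sumℚ (f ∘ suc)) + (g zero + sumℚ (g ∘ suc)) ∎
    where open ≡-Reasoning

  *-distribˡ-sum : ∀ {n} c (f : Fin n → ℚ) → c * sumℚ f ≡ sumℚ (λ i → c * f i)
  *-distribˡ-sum {zero}  c f = ℚₚ.*-zeroʳ c
  *-distribˡ-sum {suc n} c f =
    trans (ℚₚ.*-distribˡ-+ c (f zero) _) (cong (c * f zero +_) (*-distribˡ-sum c (f ∘ suc)))

  *-distribʳ-sum : ∀ {n} c (f : Fin n → ℚ) → sumℚ f * c ≡ sumℚ (λ i → f i * c)
  *-distribʳ-sum c f = trans (ℚₚ.*-comm _ c)
    (trans (*-distribˡ-sum c f) (sum-cong (λ i → ℚₚ.*-comm c (f i))))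

  neg-distrib-sum : ∀ {n} (f : Fin n → ℚ) → - sumℚ f ≡ sumℚ (λ i → - f i)
  neg-distrib-sum {zero}  f = refl
  neg-distrib-sum {suc n} f =
    trans (ℚₚ.neg-distrib-+ (f zero) _) (cong (- f zero +_) (neg-distrib-sum (f ∘ suc)))

  sum-distrib-- : ∀ {n} (f g : Fin n → ℚ) → sumℚ (λ i → f i - g i) ≡ sumℚ f - sumℚ g
  sum-distrib-- f g =
    trans (sum-distrib-+ f (λ i → - g i)) (cong (sumℚ f +_) (sym (neg-distrib-sum g)))

  sum-comm : ∀ {m n} (f : Fin m → Fin n → ℚ) →
             sumℚ (λ i → sumℚ (f i)) ≡ sumℚ (λ j → sumℚ (λ i → f i j))
  sum-comm {zero} {n} f = sym (sum-zero {n} (λ _ → refl))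
  sum-comm {suc m} f =
    trans (cong (sumℚ (f zero) +_) (sum-comm (f ∘ suc)))
          (sym (sum-distrib-+ (f zero) (λ j → sumℚ (λ i → f (suc i) j))))

  sum-++ : ∀ k {m} (f : Fin (k ℕ.+ m) → ℚ) →
           sumℚ f ≡ sumℚ (λ a → f (a ↑ˡ m)) + sumℚ (λ c → f (k ↑ʳ c))
  sum-++ zero    f = sym (ℚₚ.+-identityˡ _)
  sum-++ (suc k) f = trans (cong (f zero +_) (sum-++ k (f ∘ suc))) (sym (ℚₚ.+-assoc (f zero) _ _))

  sum-mono-≤ : ∀ {n} {f g : Fin n → ℚ} → (∀ i → f i ≤ g i) → sumℚ f ≤ sumℚ g
  sum-mono-≤ {zero}  f≤g = ℚₚ.≤-refl
  sum-mono-≤ {suc n} f≤g = ℚₚ.+-mono-≤ (f≤g zero) (sum-mono-≤ (f≤g ∘ suc))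

  sum-nonNeg : ∀ {n} {f : Fin n → ℚ} → (∀ i → 0ℚ ≤ f i) → 0ℚ ≤ sumℚ f
  sum-nonNeg {n} 0≤f = ℚₚ.≤-trans (ℚₚ.≤-reflexive (sym (sum-zero {n} (λ _ → refl)))) (sum-mono-≤ 0≤f)

  sum-nonPos : ∀ {n} {f : Fin n → ℚ} → (∀ i → f i ≤ 0ℚ) → sumℚ f ≤ 0ℚ
  sum-nonPos {n} f≤0 = ℚₚ.≤-trans (sum-mono-≤ f≤0) (ℚₚ.≤-reflexive (sum-zero {n} (λ _ → refl)))

  term≤sum : ∀ {n} {f : Fin n → ℚ} → (∀ i → 0ℚ ≤ f i) → ∀ j → f j ≤ sumℚ f
  term≤sum {suc n} {f} 0≤f zero = begin
    f zero                   ≡⟨ ℚₚ.+-identityʳ (f zero) ⟨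
    f zero + 0ℚ              ≤⟨ ℚₚ.+-monoʳ-≤ (f zero) (sum-nonNeg (0≤f ∘ suc)) ⟩
    f zero + sumℚ (f ∘ suc)  ∎
    where open ℚ-≤-Reasoning
  term≤sum {suc n} {f} 0≤f (suc j) = begin
    f (suc j)                ≤⟨ term≤sum (0≤f ∘ suc) j ⟩
    sumℚ (f ∘ suc)           ≡⟨ ℚₚ.+-identityˡ _ ⟨
    0ℚ + sumℚ (f ∘ suc)      ≤⟨ ℚₚ.+-monoˡ-≤ (sumℚ (f ∘ suc)) (0≤f zero) ⟩
    f zero + sumℚ (f ∘ suc)  ∎
    where open ℚ-≤-Reasoning

  sum-nonNeg-≤0 : ∀ {n} {f : Fin n → ℚ} → (∀ i → 0ℚ ≤ f i) → sumℚ f ≤ 0ℚ → ∀ j → f j ≡ 0ℚ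
  sum-nonNeg-≤0 0≤f ∑f≤0 j = ℚₚ.≤-antisym (ℚₚ.≤-trans (term≤sum 0≤f j) ∑f≤0) (0≤f j)

  sum-nonPos-≥0 : ∀ {n} {f : Fin n → ℚ} → (∀ i → f i ≤ 0ℚ) → 0ℚ ≤ sumℚ f → ∀ j → f j ≡ 0ℚ
  sum-nonPos-≥0 {f = f} f≤0 0≤∑f j =
    ℚₚ.neg-injective (sum-nonNeg-≤0 (ℚₚ.neg-antimono-≤ ∘ f≤0) -∑f≤0 j)
    where
    -∑f≤0 : sumℚ (λ i → - f i) ≤ 0ℚ
    -∑f≤0 = ℚₚ.≤-trans (ℚₚ.≤-reflexive (sym (neg-distrib-sum f))) (ℚₚ.neg-antimono-≤ 0≤∑f)

  δ : ∀ {n} → Fin n → Fin n → ℚ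
  δ i j = toℚ (does (i Fin.≟ j))

  δ-refl : ∀ {n} (i : Fin n) → δ i i ≡ 1ℚ
  δ-refl i = cong toℚ (dec-true (i Fin.≟ i) refl)

  δ-≢ : ∀ {n} {i j : Fin n} → i ≢ j → δ i j ≡ 0ℚ
  δ-≢ {i = i} {j} i≢j = cong toℚ (dec-false (i Fin.≟ j) i≢j)

  δ-sym : ∀ {n} (i j : Fin n) → δ i j ≡ δ j i
  δ-sym i j with i Fin.≟ j
  ... | yes refl = sym (δ-refl i)
  ... | no i≢j   = sym (δ-≢ (i≢j ∘ sym))

  sum-δ : ∀ {n} (i : Fin n) (f : Fin n → ℚ) → sumℚ (λ j → δ i j * f j) ≡ f i
  sum-δ zero f = begin
    1ℚ * f zero + sumℚ (λ j → 0ℚ * f (suc j))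
      ≡⟨ cong₂ _+_ (ℚₚ.*-identityˡ (f zero)) (sum-zero (λ j → ℚₚ.*-zeroˡ (f (suc j)))) ⟩
    f zero + 0ℚ ≡⟨ ℚₚ.+-identityʳ _ ⟩
    f zero      ∎
    where open ≡-Reasoning
  sum-δ (suc i) f = begin
    0ℚ * f zero + sumℚ (λ j → δ i j * f (suc j))
      ≡⟨ cong₂ _+_ (ℚₚ.*-zeroˡ (f zero)) (sum-δ i (f ∘ suc)) ⟩
    0ℚ + f (suc i) ≡⟨ ℚₚ.+-identityˡ _ ⟩
    f (suc i)      ∎
    where open ≡-Reasoning

  sum-δʳ : ∀ {n} (i : Fin n) (f : Fin n → ℚ) → sumℚ (λ j → f j * δ j i) ≡ f i
  sum-δʳ i f = trans (sum-cong (λ j → trans (ℚₚ.*-comm (f j) _) (cong (_* f j) (δ-sym j i))))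
                     (sum-δ i f)

  δ-injective : ∀ {m n} (f : Fin m → Fin n) → (∀ {i j} → f i ≡ f j → i ≡ j) →
                ∀ i j → δ (f i) (f j) ≡ δ i j
  δ-injective f f-injective i j with i Fin.≟ j
  ... | yes refl = δ-refl (f i)
  ... | no  i≢j  = δ-≢ (i≢j ∘ f-injective)

  0ᵥ : ∀ {n} → Vecℚ n
  0ᵥ _ = 0ℚ

  column : ∀ {m n} → Mat01 m n → Fin n → Vecℚ m
  column M c r = toℚ (M r c)

  _ᵀ : ∀ {m n} → Mat01 m n → Mat01 n m
  (M ᵀ) r c = M c r

  dot-comm : ∀ {n} (u v : Vecℚ n) → dot u v ≡ dot v u
  dot-comm u v = sum-cong (λ i → ℚₚ.*-comm (u i) (v i))

  dot-congʳ : ∀ {n} (u : Vecℚ n) {v v′ : Vecℚ n} → (∀ i → v i ≡ v′ i) → dot u v ≡ dot u v′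
  dot-congʳ u v≗v′ = sum-cong (λ i → cong (u i *_) (v≗v′ i))

  dot-zeroˡ : ∀ {n} (v : Vecℚ n) → dot 0ᵥ v ≡ 0ℚ
  dot-zeroˡ v = sum-zero (λ i → ℚₚ.*-zeroˡ (v i))

  dot-zeroʳ : ∀ {n} (u : Vecℚ n) → dot u 0ᵥ ≡ 0ℚ
  dot-zeroʳ u = sum-zero (λ i → ℚₚ.*-zeroʳ (u i))

  dot-−v : ∀ {n} (u v w : Vecℚ n) → dot u (v −v w) ≡ dot u v - dot u w
  dot-−v u v w = trans
    (sum-cong (λ i → solve 3 (λ a b c → a :* (b :+ :- c) := a :* b :+ :- (a :* c)) refl (u i) (v i) (w i)))
    (sum-distrib-- (λ i → u i * v i) (λ i → u i * w i))

  dot-*ˡ : ∀ {n} γ (u v : Vecℚ n) → dot (λ r → γ * u r) v ≡ γ * dot u v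
  dot-*ˡ γ u v =
    trans (sum-cong (λ r → ℚₚ.*-assoc γ (u r) (v r))) (sym (*-distribˡ-sum γ (λ r → u r * v r)))

  dot-negˡ : ∀ {n} (u v : Vecℚ n) → dot (λ r → - u r) v ≡ - dot u v
  dot-negˡ u v =
    trans (sum-cong (λ r → sym (ℚₚ.neg-distribˡ-* (u r) (v r)))) (sym (neg-distrib-sum (λ r → u r * v r)))

  dot-combination : ∀ {n l} (u : Vecℚ n) (c : Fin l → ℚ) (w : Fin l → Vecℚ n) →
                    dot u (λ r → sumℚ (λ j → c j * w j r)) ≡ sumℚ (λ j → c j * dot u (w j))
  dot-combination u c w = begin
    sumℚ (λ r → u r * sumℚ (λ j → c j * w j r))
      ≡⟨ sum-cong (λ r → *-distribˡ-sum (u r) (λ j → c j * w j r)) ⟩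
    sumℚ (λ r → sumℚ (λ j → u r * (c j * w j r)))
      ≡⟨ sum-comm (λ r j → u r * (c j * w j r)) ⟩
    sumℚ (λ j → sumℚ (λ r → u r * (c j * w j r)))
      ≡⟨ sum-cong (λ j → sum-cong (λ r →
           solve 3 (λ a b d → a :* (b :* d) := b :* (a :* d)) refl (u r) (c j) (w j r))) ⟩
    sumℚ (λ j → sumℚ (λ r → c j * (u r * w j r)))
      ≡⟨ sum-cong (λ j → sym (*-distribˡ-sum (c j) (λ r → u r * w j r))) ⟩
    sumℚ (λ j → c j * dot u (w j)) ∎
    where open ≡-Reasoning

  dot-mulVec : ∀ {m n} (u : Vecℚ m) (M : Mat01 m n) (x : Vecℚ n) →
               dot u (mulVec M x) ≡ sumℚ (λ j → x j * dot u (column M j))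
  dot-mulVec u M x = trans
    (dot-congʳ u (λ r → sum-cong (λ j → ℚₚ.*-comm (toℚ (M r j)) (x j))))
    (dot-combination u x (column M))

  dot-++ : ∀ {k m} (u w : Vecℚ k) (x y : Vecℚ m) → dot (u ++ x) (w ++ y) ≡ dot u w + dot x y
  dot-++ {k} u w x y = trans (sum-++ k _) (cong₂ _+_
    (sum-cong (λ a → cong₂ _*_ (lookup-++ˡ u x a) (lookup-++ˡ w y a)))
    (sum-cong (λ c → cong₂ _*_ (lookup-++ʳ u x c) (lookup-++ʳ w y c))))

  mulVec-cong : ∀ {l n} (M : Mat01 l n) {x y : Vecℚ n} → (∀ c → x c ≡ y c) →
                ∀ r → mulVec M x r ≡ mulVec M y r
  mulVec-cong M x≗y r = dot-congʳ (λ c → toℚ (M r c)) x≗y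

  mulVec-zero : ∀ {l n} (M : Mat01 l n) r → mulVec M 0ᵥ r ≡ 0ℚ
  mulVec-zero M r = dot-zeroʳ (λ c → toℚ (M r c))

  dot-scaled-zero : ∀ {n} {γ} (x v : Vecℚ n) → γ ≡ 0ℚ → dot (λ r → γ * x r) v ≡ 0ℚ
  dot-scaled-zero {γ = γ} x v γ≡0 =
    trans (dot-*ˡ γ x v) (trans (cong (_* dot x v) γ≡0) (ℚₚ.*-zeroˡ (dot x v)))

  -- Linear algebra over ℚ

  Matℚ : ℕ → ℕ → Set
  Matℚ m n = Fin m → Fin n → ℚ

  apply : ∀ {m n} → Matℚ m n → Vecℚ n → Vecℚ m
  apply M x r = sumℚ (λ c → M r c * x c)

  _·ₘ_ : ∀ {m n l} → Matℚ m n → Matℚ n l → Matℚ m l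
  (X ·ₘ Y) i j = sumℚ (λ e → X i e * Y e j)

  apply-·ₘ : ∀ {m n l} (X : Matℚ m n) (Y : Matℚ n l) (z : Vecℚ l) →
             ∀ i → apply X (apply Y z) i ≡ apply (X ·ₘ Y) z i
  apply-·ₘ X Y z i = begin
    sumℚ (λ e → X i e * sumℚ (λ c → Y e c * z c))
      ≡⟨ sum-cong (λ e → *-distribˡ-sum (X i e) (λ c → Y e c * z c)) ⟩
    sumℚ (λ e → sumℚ (λ c → X i e * (Y e c * z c)))
      ≡⟨ sum-comm (λ e c → X i e * (Y e c * z c)) ⟩
    sumℚ (λ c → sumℚ (λ e → X i e * (Y e c * z c)))
      ≡⟨ sum-cong (λ c → sum-cong (λ e → sym (ℚₚ.*-assoc (X i e) (Y e c) (z c)))) ⟩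
    sumℚ (λ c → sumℚ (λ e → X i e * Y e c * z c))
      ≡⟨ sum-cong (λ c → sym (*-distribʳ-sum (z c) (λ e → X i e * Y e c))) ⟩
    sumℚ (λ c → (X ·ₘ Y) i c * z c) ∎
    where open ≡-Reasoning

  leftInverse⇒injective : ∀ {m n} (X : Matℚ n m) (Z : Matℚ m n) → (∀ c d → (X ·ₘ Z) c d ≡ δ c d) →
                          ∀ y → (∀ e → apply Z y e ≡ 0ℚ) → ∀ d → y d ≡ 0ℚ
  leftInverse⇒injective X Z XZ≡I y Zy≡0 d = begin
    y d                        ≡⟨ sum-δ d y ⟨
    sumℚ (λ e → δ d e * y e)    ≡⟨ sum-cong (λ e → cong (_* y e) (XZ≡I d e)) ⟨
    apply (X ·ₘ Z) y d         ≡⟨ apply-·ₘ X Z y d ⟨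
    apply X (apply Z y) d      ≡⟨ sum-zero (λ e → trans (cong (X d e *_) (Zy≡0 e)) (ℚₚ.*-zeroʳ (X d e))) ⟩
    0ℚ                         ∎
    where open ≡-Reasoning

  module Elimination {m n} (M : Matℚ (suc m) (suc n)) (p : Fin (suc m)) (pivot≢0 : M p zero ≢ 0ℚ) where

    pivot⁻¹ : ℚ
    pivot⁻¹ = (1/ M p zero) {{≢-nonZero pivot≢0}}

    factor : Fin (suc m) → ℚ
    factor r = M r zero * pivot⁻¹

    reduced : Matℚ m n
    reduced i j = M (punchIn p i) (suc j) - factor (punchIn p i) * M p (suc j)

    pivotRow : Vecℚ n → ℚ
    pivotRow x = sumℚ (λ j → M p (suc j) * x j)

    extend : Vecℚ n → Vecℚ (suc n)
    extend x zero    = - (pivotRow x * pivot⁻¹)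
    extend x (suc j) = x j

    module _ (x : Vecℚ n) (x∈ker : ∀ i → apply reduced x i ≡ 0ℚ) where

      tail-punchIn : ∀ i → sumℚ (λ j → M (punchIn p i) (suc j) * x j) ≡ factor (punchIn p i) * pivotRow x
      tail-punchIn i = begin
        sumℚ (λ j → M r (suc j) * x j)
          ≡⟨ sum-cong (λ j → solve 3 (λ a b y → a :* y := (a :+ :- b) :* y :+ b :* y)
                                    refl (M r (suc j)) (factor r * M p (suc j)) (x j)) ⟩
        sumℚ (λ j → reduced i j * x j + factor r * M p (suc j) * x j)
          ≡⟨ sum-distrib-+ (λ j → reduced i j * x j) (λ j → factor r * M p (suc j) * x j) ⟩
        apply reduced x i + sumℚ (λ j → factor r * M p (suc j) * x j)
          ≡⟨ cong₂ _+_ (x∈ker i) (trans (sum-cong (λ j → ℚₚ.*-assoc (factor r) (M p (suc j)) (x j)))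
                                        (sym (*-distribˡ-sum (factor r) (λ j → M p (suc j) * x j)))) ⟩
        0ℚ + factor r * pivotRow x
          ≡⟨ ℚₚ.+-identityˡ _ ⟩
        factor r * pivotRow x ∎
        where
        open ≡-Reasoning
        r : Fin (suc m)
        r = punchIn p i

      tail : ∀ r → sumℚ (λ j → M r (suc j) * x j) ≡ factor r * pivotRow x
      tail r with p Fin.≟ r
      ... | no p≢r   = subst (λ r → sumℚ (λ j → M r (suc j) * x j) ≡ factor r * pivotRow x)
                             (Finₚ.punchIn-punchOut p≢r) (tail-punchIn (punchOut p≢r))
      ... | yes refl = sym (trans (cong (_* pivotRow x) (ℚₚ.*-inverseʳ (M p zero) {{≢-nonZero pivot≢0}}))
                                  (ℚₚ.*-identityˡ (pivotRow x)))

      extend-kernel : ∀ r → apply M (extend x) r ≡ 0ℚ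
      extend-kernel r = begin
        M r zero * - (pivotRow x * pivot⁻¹) + sumℚ (λ j → M r (suc j) * x j)
          ≡⟨ cong (M r zero * - (pivotRow x * pivot⁻¹) +_) (tail r) ⟩
        M r zero * - (pivotRow x * pivot⁻¹) + M r zero * pivot⁻¹ * pivotRow x
          ≡⟨ solve 3 (λ a s t → a :* :- (s :* t) :+ a :* t :* s := con 0ℚ)
                   refl (M r zero) (pivotRow x) pivot⁻¹ ⟩
        0ℚ ∎
        where open ≡-Reasoning

  nontrivialKernel : ∀ {m n} → m ℕ.< n → (M : Matℚ m n) →
                     ∃ λ x → (∃ λ j → x j ≢ 0ℚ) × (∀ r → apply M x r ≡ 0ℚ)
  nontrivialKernel {zero}  {suc n} _ M = (λ _ → 1ℚ) , (zero , ℚₚ.1≢0) , λ ()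
  nontrivialKernel {suc m} {suc n} (s≤s m<n) M with Finₚ.any? (λ r → ¬? (M r zero ≟ 0ℚ))
  ... | yes (p , pivot≢0) =
    let open Elimination M p pivot≢0
        (x , (j , xⱼ≢0) , x∈ker) = nontrivialKernel m<n reduced
    in extend x , (suc j , xⱼ≢0) , extend-kernel x x∈ker
  ... | no no-pivot = δ zero , (zero , ℚₚ.1≢0) , e₀∈ker
    where
    e₀∈ker : ∀ r → apply M (δ zero) r ≡ 0ℚ
    e₀∈ker r = trans
      (cong₂ _+_ (trans (ℚₚ.*-identityʳ (M r zero))
                        (decidable-stable (M r zero ≟ 0ℚ) (λ ≢0 → no-pivot (r , ≢0))))
                 (sum-zero (λ j → ℚₚ.*-zeroʳ (M r (suc j)))))
      (ℚₚ.+-identityʳ 0ℚ)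

  augment : ∀ {n} → Vecℚ n → Mat01 n n → Matℚ n (suc n)
  augment b M r zero    = b r
  augment b M r (suc c) = toℚ (M r c)

  nonsingular⇒surjective : ∀ {n} (M : Mat01 n n) → Nonsingular M →
                           (b : Vecℚ n) → ∃ λ x → ∀ r → mulVec M x r ≡ b r
  nonsingular⇒surjective {n} M ns b = fromKernel (nontrivialKernel (ℕₚ.n<1+n n) (augment b M))
    where
    fromKernel : (∃ λ x → (∃ λ j → x j ≢ 0ℚ) × (∀ r → apply (augment b M) x r ≡ 0ℚ)) →
                 ∃ λ y → ∀ r → mulVec M y r ≡ b r
    fromKernel (x , (j , xⱼ≢0) , x∈ker) with x zero ≟ 0ℚ
    ... | yes x₀≡0 = ⊥-elim (xⱼ≢0 (x≡0 j))
      where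
      x≡0 : ∀ j → x j ≡ 0ℚ
      x≡0 zero    = x₀≡0
      x≡0 (suc c) = ns (x ∘ suc) (λ r → begin
        mulVec M (x ∘ suc) r               ≡⟨ ℚₚ.+-identityˡ _ ⟨
        0ℚ + mulVec M (x ∘ suc) r          ≡⟨ cong (_+ mulVec M (x ∘ suc) r)
                                                   (trans (cong (b r *_) x₀≡0) (ℚₚ.*-zeroʳ (b r))) ⟨
        b r * x zero + mulVec M (x ∘ suc) r ≡⟨ x∈ker r ⟩
        0ℚ ∎) c
        where open ≡-Reasoning
    ... | no x₀≢0 = (λ c → x (suc c) * t) , solves
      where
      t : ℚ
      t = - (1/ x zero) {{≢-nonZero x₀≢0}}
      solves : ∀ r → mulVec M (λ c → x (suc c) * t) r ≡ b r
      solves r = begin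
        sumℚ (λ c → toℚ (M r c) * (x (suc c) * t))
          ≡⟨ sum-cong (λ c → sym (ℚₚ.*-assoc (toℚ (M r c)) (x (suc c)) t)) ⟩
        sumℚ (λ c → toℚ (M r c) * x (suc c) * t)
          ≡⟨ *-distribʳ-sum t (λ c → toℚ (M r c) * x (suc c)) ⟨
        mulVec M (x ∘ suc) r * t
          ≡⟨ cong (_* t) (inverseʳ-unique (b r * x zero) _ (x∈ker r)) ⟩
        - (b r * x zero) * t
          ≡⟨ solve 3 (λ a y i → (:- (a :* y)) :* :- i := a :* (y :* i))
                   refl (b r) (x zero) ((1/ x zero) {{≢-nonZero x₀≢0}}) ⟩
        b r * (x zero * (1/ x zero) {{≢-nonZero x₀≢0}})
          ≡⟨ cong (b r *_) (ℚₚ.*-inverseʳ (x zero) {{≢-nonZero x₀≢0}}) ⟩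
        b r * 1ℚ
          ≡⟨ ℚₚ.*-identityʳ (b r) ⟩
        b r ∎
        where open ≡-Reasoning

  nonsingular-ᵀ : ∀ {n} (M : Mat01 n n) → Nonsingular M → Nonsingular (M ᵀ)
  nonsingular-ᵀ {n} M ns y Mᵀy≡0 i = begin
    y i                                    ≡⟨ sum-δʳ i y ⟨
    dot y (λ r → δ r i)                    ≡⟨ dot-congʳ y (λ r → sym (Mx≡δᵢ r)) ⟩
    dot y (mulVec M x)                     ≡⟨ dot-mulVec y M x ⟩
    sumℚ (λ c → x c * dot y (column M c))  ≡⟨ sum-zero (λ c → trans (cong (x c *_) (y·Mc≡0 c))
                                                                   (ℚₚ.*-zeroʳ (x c))) ⟩
    0ℚ ∎
    where
    open ≡-Reasoning
    x : Vecℚ n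
    x = proj₁ (nonsingular⇒surjective M ns (λ r → δ r i))
    Mx≡δᵢ : ∀ r → mulVec M x r ≡ δ r i
    Mx≡δᵢ = proj₂ (nonsingular⇒surjective M ns (λ r → δ r i))
    y·Mc≡0 : ∀ c → dot y (column M c) ≡ 0ℚ
    y·Mc≡0 c = trans (dot-comm y (column M c)) (Mᵀy≡0 c)

  nonsingular⇒dual-solvable : ∀ {n} (M : Mat01 n n) → Nonsingular M →
                              (b : Vecℚ n) → ∃ λ y → ∀ c → dot y (column M c) ≡ b c
  nonsingular⇒dual-solvable M ns b =
    let (y , Mᵀy≡b) = nonsingular⇒surjective (M ᵀ) (nonsingular-ᵀ M ns) b
    in y , λ c → trans (dot-comm y (column M c)) (Mᵀy≡b c)

  -- K (g + W ι) = 0 gives g = - W ι; as g ≤ 0 and W ≤ 0 off the diagonal, W vanishes between C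
  -- and its complement, and then so does its inverse K.
  module _ {m} (K W : Matℚ m m)
           (K-sym : ∀ c d → K c d ≡ K d c) (W-sym : ∀ c d → W c d ≡ W d c)
           (KW≡I : ∀ c d → (K ·ₘ W) c d ≡ δ c d)
           (W-offDiag≤0 : ∀ c d → c ≢ d → W c d ≤ 0ℚ)
           (C : Fin m → Bool) (g : Vecℚ m)
           (g≤0 : ∀ e → g e ≤ 0ℚ) (Kg≡-C : ∀ c → apply K g c ≡ - toℚ (C c)) where

    private
      ι : Vecℚ m
      ι c = toℚ (C c)

      ∈-∉⇒≢ : ∀ {c d} → C c ≡ true → C d ≡ false → c ≢ d
      ∈-∉⇒≢ c∈C d∉C refl with trans (sym c∈C) d∉C
      ... | ()

      WK≡I : ∀ c d → (W ·ₘ K) c d ≡ δ c d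
      WK≡I c d = begin
        sumℚ (λ e → W c e * K e d)  ≡⟨ sum-cong (λ e → trans (ℚₚ.*-comm (W c e) (K e d))
                                                             (cong₂ _*_ (K-sym e d) (W-sym c e))) ⟩
        sumℚ (λ e → K d e * W e c)  ≡⟨ KW≡I d c ⟩
        δ d c                       ≡⟨ δ-sym d c ⟩
        δ c d                       ∎
        where open ≡-Reasoning

      g+Wι≡0 : ∀ e → g e + apply W ι e ≡ 0ℚ
      g+Wι≡0 = leftInverse⇒injective W K WK≡I (λ e → g e + apply W ι e) K[g+Wι]≡0
        where
        K[g+Wι]≡0 : ∀ c → apply K (λ e → g e + apply W ι e) c ≡ 0ℚ
        K[g+Wι]≡0 c = begin
          sumℚ (λ e → K c e * (g e + apply W ι e))
            ≡⟨ sum-cong (λ e → ℚₚ.*-distribˡ-+ (K c e) (g e) (apply W ι e)) ⟩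
          sumℚ (λ e → K c e * g e + K c e * apply W ι e)
            ≡⟨ sum-distrib-+ (λ e → K c e * g e) (λ e → K c e * apply W ι e) ⟩
          apply K g c + apply K (apply W ι) c
            ≡⟨ cong₂ _+_ (Kg≡-C c) (apply-·ₘ K W ι c) ⟩
          - ι c + apply (K ·ₘ W) ι c
            ≡⟨ cong (- ι c +_) (trans (sum-cong (λ d → cong (_* ι d) (KW≡I c d))) (sum-δ c ι)) ⟩
          - ι c + ι c
            ≡⟨ ℚₚ.+-inverseˡ (ι c) ⟩
          0ℚ ∎
          where open ≡-Reasoning

      W-separates : ∀ c d → C c ≡ true → C d ≡ false → W d c ≡ 0ℚ
      W-separates c d c∈C d∉C = trans (sym (ℚₚ.*-identityʳ (W d c)))
        (trans (cong (λ b → W d c * toℚ b) (sym c∈C)) (sum-nonPos-≥0 terms≤0 0≤Wιd c))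
        where
        terms≤0 : ∀ e → W d e * ι e ≤ 0ℚ
        terms≤0 e with C e in Cₑ≡
        ... | true  = subst (_≤ 0ℚ) (sym (ℚₚ.*-identityʳ (W d e)))
                            (W-offDiag≤0 d e (∈-∉⇒≢ Cₑ≡ d∉C ∘ sym))
        ... | false = ℚₚ.≤-reflexive (ℚₚ.*-zeroʳ (W d e))
        0≤Wιd : 0ℚ ≤ apply W ι d
        0≤Wιd = subst (0ℚ ≤_) (sym (inverseʳ-unique (g d) _ (g+Wι≡0 d))) (ℚₚ.neg-antimono-≤ (g≤0 d))

      Wι≡ιW : ∀ f e → W f e * ι e ≡ ι f * W f e
      Wι≡ιW f e with C f in C_f | C e in C_e
      ... | true  | true  = trans (ℚₚ.*-identityʳ (W f e)) (sym (ℚₚ.*-identityˡ (W f e)))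
      ... | false | false = trans (ℚₚ.*-zeroʳ (W f e)) (sym (ℚₚ.*-zeroˡ (W f e)))
      ... | true  | false = trans (ℚₚ.*-zeroʳ (W f e))
                                  (sym (trans (ℚₚ.*-identityˡ (W f e)) (trans (W-sym f e) (W-separates f e C_f C_e))))
      ... | false | true  = trans (cong (_* 1ℚ) (W-separates e f C_e C_f)) (sym (ℚₚ.*-zeroˡ (W f e)))

    K-separates : ∀ c d → C c ≡ true → C d ≡ false → K c d ≡ 0ℚ
    K-separates c d c∈C d∉C = trans (sym (ℚₚ.*-identityˡ (K c d)))
      (trans (cong (λ b → toℚ b * K c d) (sym c∈C)) (leftInverse⇒injective K W KW≡I y Wy≡0 c))
      where
      y : Vecℚ m
      y e = ι e * K e d
      ιδ≡0 : ∀ f → ι f * δ f d ≡ 0ℚ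
      ιδ≡0 f with f Fin.≟ d
      ... | yes refl = trans (cong (λ b → toℚ b * 1ℚ) d∉C) (ℚₚ.*-zeroˡ 1ℚ)
      ... | no  _    = ℚₚ.*-zeroʳ (ι f)
      Wy≡0 : ∀ f → apply W y f ≡ 0ℚ
      Wy≡0 f = begin
        sumℚ (λ e → W f e * (ι e * K e d))  ≡⟨ sum-cong (λ e → begin
            W f e * (ι e * K e d)             ≡⟨ ℚₚ.*-assoc (W f e) (ι e) (K e d) ⟨
            W f e * ι e * K e d               ≡⟨ cong (_* K e d) (Wι≡ιW f e) ⟩
            ι f * W f e * K e d               ≡⟨ ℚₚ.*-assoc (ι f) (W f e) (K e d) ⟩
            ι f * (W f e * K e d)             ∎) ⟩
        sumℚ (λ e → ι f * (W f e * K e d))  ≡⟨ *-distribˡ-sum (ι f) (λ e → W f e * K e d) ⟨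
        ι f * (W ·ₘ K) f d                  ≡⟨ cong (ι f *_) (WK≡I f d) ⟩
        ι f * δ f d                         ≡⟨ ιδ≡0 f ⟩
        0ℚ                                  ∎
        where open ≡-Reasoning

  -- Facet normals of the simplex conv{0, columns of M}

  record FacetNormal {n} (M : Mat01 n n) (i : Fin (suc n)) (u : Vecℚ n) (κ : ℚ) : Set where
    constructor facetNormal
    field
      on-facet : ∀ a → a ≢ i → dot u (vertex M a) ≡ κ
      beyond   : κ < dot u (vertex M i)

  facetNormal⇒inwardNormal : ∀ {n} {M : Mat01 n n} {i u κ} → FacetNormal M i u κ → InwardNormal M i u
  facetNormal⇒inwardNormal {M = M} {i} {u} {κ} (facetNormal on-facet beyond) = orthogonal , inward
    where
    orthogonal : ∀ a b → a ≢ i → b ≢ i → dot u (vertex M a −v vertex M b) ≡ 0ℚ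
    orthogonal a b a≢i b≢i = trans (dot-−v u _ _)
      (trans (cong₂ _-_ (on-facet a a≢i) (on-facet b b≢i)) (ℚₚ.+-inverseʳ κ))
    inward : ∀ b → b ≢ i → 0ℚ < dot u (vertex M i −v vertex M b)
    inward b b≢i = subst (0ℚ <_)
      (sym (trans (dot-−v u _ _) (cong (λ t → dot u (vertex M i) - t) (on-facet b b≢i))))
      (x<y⇒0<y-x beyond)

  inwardNormal⇒facetNormal : ∀ {n} {M : Mat01 n n} {i b u} → b ≢ i → InwardNormal M i u →
                             FacetNormal M i u (dot u (vertex M b))
  inwardNormal⇒facetNormal {M = M} {i} {b} {u} b≢i (orthogonal , inward) =
    facetNormal (λ a a≢i → x∙y⁻¹≈ε⇒x≈y _ _ (trans (sym (dot-−v u _ _)) (orthogonal a b a≢i b≢i)))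
                (0<y-x⇒x<y (subst (0ℚ <_) (dot-−v u _ _) (inward b b≢i)))

  inwardNormal⇒facetNormal′ : ∀ {n} {M : Mat01 n n} {i u} → 1 ℕ.≤ n → InwardNormal M i u →
                              ∃ λ κ → FacetNormal M i u κ
  inwardNormal⇒facetNormal′ {M = M} {i} {u} 1≤n normal =
    _ , inwardNormal⇒facetNormal {M = M} {u = u} (Finₚ.punchInᵢ≢i i (fromℕ< 1≤n)) normal

  nonobtuse-facetNormals : ∀ {n} {M : Mat01 n n} {i j u w κ κ′} → NonobtuseSimplex M → i ≢ j →
                           FacetNormal M i u κ → FacetNormal M j w κ′ → dot u w ≤ 0ℚ
  nonobtuse-facetNormals {i = i} {j} {u} {w} nonobtuse i≢j u-normal w-normal =
    proj₂ nonobtuse i j i≢j u w (facetNormal⇒inwardNormal u-normal) (facetNormal⇒inwardNormal w-normal)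

  module DualBasis {n} (M : Mat01 n n) (ns : Nonsingular M) where

    q : Fin n → Vecℚ n
    q i = proj₁ (nonsingular⇒dual-solvable M ns (δ i))

    q-column : ∀ i j → dot (q i) (column M j) ≡ δ i j
    q-column i = proj₂ (nonsingular⇒dual-solvable M ns (δ i))

    s : Vecℚ n
    s = proj₁ (nonsingular⇒dual-solvable M ns (λ _ → 1ℚ))

    s-column : ∀ j → dot s (column M j) ≡ 1ℚ
    s-column = proj₂ (nonsingular⇒dual-solvable M ns (λ _ → 1ℚ))

    q-vertex : ∀ i b → dot (q i) (vertex M b) ≡ δ (suc i) b
    q-vertex i zero    = dot-zeroʳ (q i)
    q-vertex i (suc j) = q-column i j

    coordinates : ∀ {x v} → (∀ r → mulVec M x r ≡ v r) → ∀ j → x j ≡ dot (q j) v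
    coordinates {x} {v} Mx≡v j = begin
      x j                                        ≡⟨ sum-δʳ j x ⟨
      sumℚ (λ l → x l * δ l j)                   ≡⟨ sum-cong (λ l → cong (x l *_) (δ-sym l j)) ⟩
      sumℚ (λ l → x l * δ j l)                   ≡⟨ sum-cong (λ l → cong (x l *_) (q-column j l)) ⟨
      sumℚ (λ l → x l * dot (q j) (column M l))  ≡⟨ dot-mulVec (q j) M x ⟨
      dot (q j) (mulVec M x)                     ≡⟨ dot-congʳ (q j) Mx≡v ⟩
      dot (q j) v                                ∎
      where open ≡-Reasoning

    expansion : ∀ v w → dot w v ≡ sumℚ (λ j → dot (column M j) v * dot w (q j))
    expansion v w = trans (dot-congʳ w v≗v′) (dot-combination w c q)
      where
      c : Fin n → ℚ
      c j = dot (column M j) v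
      v′ : Vecℚ n
      v′ r = sumℚ (λ j → c j * q j r)
      columns⊥v-v′ : ∀ l → dot (column M l) (v −v v′) ≡ 0ℚ
      columns⊥v-v′ l = begin
        dot (column M l) (v −v v′)
          ≡⟨ dot-−v (column M l) v v′ ⟩
        c l - dot (column M l) v′
          ≡⟨ cong (λ t → c l - t) (dot-combination (column M l) c q) ⟩
        c l - sumℚ (λ j → c j * dot (column M l) (q j))
          ≡⟨ cong (λ t → c l - t) (sum-cong (λ j → cong (c j *_) (trans (dot-comm _ (q j)) (q-column j l)))) ⟩
        c l - sumℚ (λ j → c j * δ j l)
          ≡⟨ cong (λ t → c l - t) (sum-δʳ l c) ⟩
        c l - c l
          ≡⟨ ℚₚ.+-inverseʳ (c l) ⟩
        0ℚ ∎
        where open ≡-Reasoning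
      v≗v′ : ∀ r → v r ≡ v′ r
      v≗v′ r = x∙y⁻¹≈ε⇒x≈y (v r) (v′ r) (nonsingular-ᵀ M ns (v −v v′) columns⊥v-v′ r)

    -- x ↦ normal i · x - level i is the barycentric coordinate of vertex i.
    normal : Fin (suc n) → Vecℚ n
    normal zero    r = - s r
    normal (suc i)   = q i

    level : Fin (suc n) → ℚ
    level zero    = - 1ℚ
    level (suc i) = 0ℚ

    normal-facet : ∀ i b → b ≢ i → dot (normal i) (vertex M b) ≡ level i
    normal-facet zero    zero    0≢0 = ⊥-elim (0≢0 refl)
    normal-facet zero    (suc j) _   = trans (dot-negˡ s (column M j)) (cong -_ (s-column j))
    normal-facet (suc i) b       b≢i = trans (q-vertex i b) (δ-≢ (b≢i ∘ sym))

    normal-vertex : ∀ i → dot (normal i) (vertex M i) ≡ level i + 1ℚ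
    normal-vertex zero    = dot-zeroʳ (normal zero)
    normal-vertex (suc i) = trans (q-column i i) (δ-refl i)

    normal-facetNormal : ∀ i → FacetNormal M i (normal i) (level i)
    normal-facetNormal i = facetNormal (normal-facet i) $ subst (level i <_) (sym (normal-vertex i)) (level<level+1 i)
      where
      level<level+1 : ∀ i → level i < level i + 1ℚ
      level<level+1 zero    = ℚₚ.neg-antimono-< (ℚₚ.positive⁻¹ 1ℚ)
      level<level+1 (suc i) = ℚₚ.positive⁻¹ 1ℚ

    module _ (nonobtuse : NonobtuseSimplex M) where

      normal·normal≤0 : ∀ i j → i ≢ j → dot (normal i) (normal j) ≤ 0ℚ
      normal·normal≤0 i j i≢j =
        nonobtuse-facetNormals nonobtuse i≢j (normal-facetNormal i) (normal-facetNormal j)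

      q·q≤0 : ∀ i j → i ≢ j → dot (q i) (q j) ≤ 0ℚ
      q·q≤0 i j i≢j = normal·normal≤0 (suc i) (suc j) (i≢j ∘ Finₚ.suc-injective)

      0≤q·s : ∀ i → 0ℚ ≤ dot (q i) s
      0≤q·s i = subst (0ℚ ≤_) (⁻¹-involutive (dot (q i) s)) (ℚₚ.neg-antimono-≤ q·-s≤0)
        where
        q·-s≤0 : - dot (q i) s ≤ 0ℚ
        q·-s≤0 = subst (_≤ 0ℚ) (trans (dot-comm (q i) _) (trans (dot-negˡ s (q i)) (cong -_ (dot-comm s (q i)))))
                       (normal·normal≤0 (suc i) zero (λ ()))

  toℚ-*≤ : ∀ b {x} → 0ℚ ≤ x → toℚ b * x ≤ x
  toℚ-*≤ true  {x} _   = ℚₚ.≤-reflexive (ℚₚ.*-identityˡ x)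
  toℚ-*≤ false {x} 0≤x = ℚₚ.≤-trans (ℚₚ.≤-reflexive (ℚₚ.*-zeroˡ x)) 0≤x

  zeroOne-subconvex⇒zero⊎column :
    ∀ {k l} (N : Mat01 k l) (ρ : Fin k → Bool) (w : Fin l → ℚ) →
    (∀ a → 0ℚ ≤ w a) → sumℚ w ≤ 1ℚ → (∀ i → toℚ (ρ i) ≡ mulVec N w i) →
    (∀ i → ρ i ≡ false) ⊎ ∃ λ a → ∀ i → ρ i ≡ N i a
  zeroOne-subconvex⇒zero⊎column N ρ w 0≤w ∑w≤1 ρ≡Nw with Finₚ.any? (λ a → 0ℚ ℚₚ.<? w a)
  ... | no w≯0 = inj₁ (λ i → toℚ-injective (trans (ρ≡Nw i) (sum-zero (λ a →
        trans (cong (toℚ (N i a) *_) (w≡0 a)) (ℚₚ.*-zeroʳ (toℚ (N i a)))))))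
    where
    w≡0 : ∀ a → w a ≡ 0ℚ
    w≡0 a = ℚₚ.≤-antisym (ℚₚ.≮⇒≥ (λ 0<wₐ → w≯0 (a , 0<wₐ))) (0≤w a)
  ... | yes (a , 0<wₐ) = inj₂ (a , ρ≡Nₐ)
    -- Where column a is 1, ρ ≥ wₐ > 0; where it is 0, ρ ≤ Σ w - wₐ < 1.
    where
    Nw-terms≥0 : ∀ i b → 0ℚ ≤ toℚ (N i b) * w b
    Nw-terms≥0 i b = *-nonNeg (0≤toℚ (N i b)) (0≤w b)

    wₐ≤ρᵢ : ∀ i → N i a ≡ true → w a ≤ toℚ (ρ i)
    wₐ≤ρᵢ i Nᵢₐ≡true = begin
      w a                    ≡⟨ ℚₚ.*-identityˡ (w a) ⟨
      toℚ true * w a         ≡⟨ cong (λ b → toℚ b * w a) Nᵢₐ≡true ⟨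
      toℚ (N i a) * w a      ≤⟨ term≤sum (Nw-terms≥0 i) a ⟩
      mulVec N w i           ≡⟨ ρ≡Nw i ⟨
      toℚ (ρ i)              ∎
      where open ℚ-≤-Reasoning

    wₐ≤1-ρᵢ : ∀ i → N i a ≡ false → w a ≤ 1ℚ - toℚ (ρ i)
    wₐ≤1-ρᵢ i Nᵢₐ≡false = begin
      w a
        ≡⟨ solve 2 (λ r x → x := (r :+ x) :+ :- r) refl (toℚ (ρ i)) (w a) ⟩
      toℚ (ρ i) + w a - toℚ (ρ i)
        ≡⟨ cong (λ t → t + w a - toℚ (ρ i)) (ρ≡Nw i) ⟩
      mulVec N w i + w a - toℚ (ρ i)
        ≡⟨ cong (λ t → mulVec N w i + t - toℚ (ρ i)) (sum-δ a w) ⟨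
      mulVec N w i + sumℚ (λ b → δ a b * w b) - toℚ (ρ i)
        ≡⟨ cong (_- toℚ (ρ i)) (sum-distrib-+ (λ b → toℚ (N i b) * w b) (λ b → δ a b * w b)) ⟨
      sumℚ (λ b → toℚ (N i b) * w b + δ a b * w b) - toℚ (ρ i)
        ≤⟨ ℚₚ.+-monoˡ-≤ (- toℚ (ρ i)) (sum-mono-≤ term≤wᵦ) ⟩
      sumℚ w - toℚ (ρ i)
        ≤⟨ ℚₚ.+-monoˡ-≤ (- toℚ (ρ i)) ∑w≤1 ⟩
      1ℚ - toℚ (ρ i) ∎
      where
      open ℚ-≤-Reasoning
      term≤wᵦ : ∀ b → toℚ (N i b) * w b + δ a b * w b ≤ w b
      term≤wᵦ b with a Fin.≟ b
      ... | yes refl = ℚₚ.≤-reflexive (begin-equality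
        toℚ (N i a) * w a + 1ℚ * w a  ≡⟨ cong₂ _+_ (cong (λ c → toℚ c * w a) Nᵢₐ≡false)
                                                   (ℚₚ.*-identityˡ (w a)) ⟩
        0ℚ * w a + w a                ≡⟨ cong (_+ w a) (ℚₚ.*-zeroˡ (w a)) ⟩
        0ℚ + w a                      ≡⟨ ℚₚ.+-identityˡ (w a) ⟩
        w a                           ∎)
      ... | no _ = begin
        toℚ (N i b) * w b + 0ℚ * w b  ≡⟨ cong (toℚ (N i b) * w b +_) (ℚₚ.*-zeroˡ (w b)) ⟩
        toℚ (N i b) * w b + 0ℚ        ≡⟨ ℚₚ.+-identityʳ _ ⟩
        toℚ (N i b) * w b             ≤⟨ toℚ-*≤ (N i b) (0≤w b) ⟩
        w b                           ∎

    wₐ≰0 : ¬ (w a ≤ 0ℚ)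
    wₐ≰0 wₐ≤0 = ℚₚ.<-irrefl refl (ℚₚ.<-≤-trans 0<wₐ wₐ≤0)

    ρ≡Nₐ : ∀ i → ρ i ≡ N i a
    ρ≡Nₐ i with ρ i in ρᵢ≡ | N i a in Nᵢₐ≡
    ... | false | false = refl
    ... | true  | true  = refl
    ... | false | true  = ⊥-elim (wₐ≰0 (subst (w a ≤_) (cong toℚ ρᵢ≡) (wₐ≤ρᵢ i Nᵢₐ≡)))
    ... | true  | false = ⊥-elim (wₐ≰0 (subst (w a ≤_)
                                              (trans (cong (λ b → 1ℚ - toℚ b) ρᵢ≡) (ℚₚ.+-inverseʳ 1ℚ))
                                              (wₐ≤1-ρᵢ i Nᵢₐ≡)))

  gram≡0⇒disjoint : ∀ {m n} (A : Mat01 m n) c d → dot (column A c) (column A d) ≡ 0ℚ →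
                    ∀ r → A r c ≡ true → A r d ≡ false
  gram≡0⇒disjoint A c d Aᶜ·Aᵈ≡0 r Aᵣ꜀≡true with A r d in Aᵣ𝒹≡
  ... | false = refl
  ... | true  = ⊥-elim (ℚₚ.1≢0 (begin
    1ℚ                           ≡⟨ cong₂ (λ x y → toℚ x * toℚ y) Aᵣ꜀≡true Aᵣ𝒹≡ ⟨
    toℚ (A r c) * toℚ (A r d)    ≡⟨ sum-nonNeg-≤0 (λ r → *-nonNeg (0≤toℚ (A r c)) (0≤toℚ (A r d)))
                                                  (ℚₚ.≤-reflexive Aᶜ·Aᵈ≡0) r ⟩
    0ℚ                           ∎))
    where open ≡-Reasoning

  vertex⇒zero⊎column : ∀ {k} (N : Mat01 k k) (ρ : Fin k → Bool) σ →
                       (∀ i → toℚ (ρ i) ≡ vertex N σ i) →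
                       (∀ i → ρ i ≡ false) ⊎ ∃ λ j → ∀ i → ρ i ≡ N i j
  vertex⇒zero⊎column N ρ zero    ρ≡vertex = inj₁ (toℚ-injective ∘ ρ≡vertex)
  vertex⇒zero⊎column N ρ (suc j) ρ≡vertex = inj₂ (j , toℚ-injective ∘ ρ≡vertex)

  zero⊎column⇒vertex : ∀ {k} (N : Mat01 k k) (ρ : Fin k → Bool) →
                       (∀ i → ρ i ≡ false) ⊎ ∃ (λ j → ∀ i → ρ i ≡ N i j) →
                       ∃ λ σ → ∀ i → toℚ (ρ i) ≡ vertex N σ i
  zero⊎column⇒vertex N ρ (inj₁ ρ≡0)       = zero  , cong toℚ ∘ ρ≡0
  zero⊎column⇒vertex N ρ (inj₂ (j , ρ≡Nⱼ)) = suc j , cong toℚ ∘ ρ≡Nⱼ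

  -- Partly decomposable matrices

  count : ∀ {m} → (Fin m → Bool) → ℕ
  count {zero}  S = 0
  count {suc m} S = if S zero then suc (count (S ∘ suc)) else count (S ∘ suc)

  count≤m : ∀ {m} (S : Fin m → Bool) → count S ℕ.≤ m
  count≤m {zero}  S = z≤n
  count≤m {suc m} S with S zero
  ... | true  = s≤s (count≤m (S ∘ suc))
  ... | false = ℕₚ.m≤n⇒m≤1+n (count≤m (S ∘ suc))

  count+count-not : ∀ {m} (S : Fin m → Bool) → count S ℕ.+ count (not ∘ S) ≡ m
  count+count-not {zero}  S = refl
  count+count-not {suc m} S with S zero
  ... | true  = cong suc (count+count-not (S ∘ suc))
  ... | false = trans (ℕₚ.+-suc (count (S ∘ suc)) _) (cong suc (count+count-not (S ∘ suc)))

  count>0 : ∀ {m} (S : Fin m → Bool) {i} → S i ≡ true → 0 ℕ.< count S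
  count>0 {suc m} S {zero}  Sᵢ≡true rewrite Sᵢ≡true = s≤s z≤n
  count>0 {suc m} S {suc i} Sᵢ≡true with S zero
  ... | true  = s≤s z≤n
  ... | false = count>0 (S ∘ suc) Sᵢ≡true

  SortsAt : ∀ {m} → (Fin m → Bool) → ℕ → Permutation′ m → Fin m → Set
  SortsAt S c π i = (toℕ i ℕ.< c → S (π ⟨$⟩ʳ i) ≡ true) ×
                    (c ℕ.≤ toℕ i → S (π ⟨$⟩ʳ i) ≡ false)

  Sorts : ∀ {m} → (Fin m → Bool) → ℕ → Permutation′ m → Set
  Sorts S c π = ∀ i → SortsAt S c π i

  insert-self : ∀ {m n} i j (π : Permutation m n) → insert i j π ⟨$⟩ʳ i ≡ j
  insert-self i j π with i Fin.≟ i
  ... | yes _   = refl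
  ... | no i≢i = contradiction refl i≢i

  toℕ-punchIn-< : ∀ {n} (i : Fin (suc n)) (j : Fin n) → toℕ j ℕ.< toℕ i → toℕ (punchIn i j) ≡ toℕ j
  toℕ-punchIn-< (suc i) zero    _         = refl
  toℕ-punchIn-< (suc i) (suc j) (s≤s j<i) = cong suc (toℕ-punchIn-< i j j<i)

  toℕ-≤-punchIn : ∀ {n} (i : Fin (suc n)) (j : Fin n) → toℕ j ℕ.≤ toℕ (punchIn i j)
  toℕ-≤-punchIn zero    j       = ℕₚ.n≤1+n (toℕ j)
  toℕ-≤-punchIn (suc i) zero    = z≤n
  toℕ-≤-punchIn (suc i) (suc j) = s≤s (toℕ-≤-punchIn i j)

  sortingPermutation : ∀ {m} (S : Fin m → Bool) → Σ (Permutation′ m) (Sorts S (count S))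
  sortingPermutation {zero}  S = Perm.id , λ ()
  sortingPermutation {suc m} S with S zero in S₀≡ | sortingPermutation (S ∘ suc)
  ... | true  | π , sorts = lift₀ π , sorts′
    where
    sorts′ : Sorts S (suc (count (S ∘ suc))) (lift₀ π)
    sorts′ zero    = (λ _ → S₀≡) , λ ()
    sorts′ (suc i) = (λ { (s≤s i<c) → proj₁ (sorts i) i<c }) , λ { (s≤s c≤i) → proj₂ (sorts i) c≤i }
  ... | false | π , sorts = insert t zero π , sorts′
    where
    c : ℕ
    c = count (S ∘ suc)
    t : Fin (suc m)
    t = fromℕ< (s≤s (count≤m (S ∘ suc)))
    toℕt≡c : toℕ t ≡ c
    toℕt≡c = Finₚ.toℕ-fromℕ< (s≤s (count≤m (S ∘ suc)))
    sorts-punchIn : ∀ k → SortsAt S c (insert t zero π) (punchIn t k)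
    sorts-punchIn k rewrite insert-punchIn t zero π k =
      (λ i<c → proj₁ (sorts k) (ℕₚ.≤-<-trans (toℕ-≤-punchIn t k) i<c)) ,
      (λ c≤i → proj₂ (sorts k) (ℕₚ.≮⇒≥ (λ k<c → ℕₚ.<⇒≱ (i<c k<c) c≤i)))
      where
      i<c : toℕ k ℕ.< c → toℕ (punchIn t k) ℕ.< c
      i<c k<c = subst (ℕ._< c) (sym (toℕ-punchIn-< t k (subst (toℕ k ℕ.<_) (sym toℕt≡c) k<c))) k<c
    sorts-at : ∀ i → Dec (t ≡ i) → SortsAt S c (insert t zero π) i
    sorts-at i (yes refl) = (λ t<c → contradiction (subst (ℕ._< c) toℕt≡c t<c) (ℕₚ.<-irrefl refl)) ,
                            (λ _ → trans (cong S (insert-self t zero π)) S₀≡)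
    sorts-at i (no t≢i)   = subst (SortsAt S c (insert t zero π)) (Finₚ.punchIn-punchOut t≢i)
                                  (sorts-punchIn (punchOut t≢i))
    sorts′ : Sorts S c (insert t zero π)
    sorts′ i = sorts-at i (t Fin.≟ i)

  zeroBlock⇒partlyDecomposable : ∀ {m} (A : Mat01 m m) (Rows Cols : Fin m → Bool) →
    (∀ r c → Rows r ≡ true → Cols c ≡ true → A r c ≡ false) →
    0 ℕ.< count Cols → count Cols ℕ.< m → m ℕ.≤ count Rows ℕ.+ count Cols → PartlyDecomposable A
  zeroBlock⇒partlyDecomposable {m} A Rows Cols zero-block 0<j j<m m≤r+j =
    count Cols , 0<j , j<m , σ , τ , λ r c j≤r c<j →
      zero-block (σ ⟨$⟩ʳ r) (τ ⟨$⟩ʳ c)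
        (not-injective (proj₂ (σ-sorts r) (ℕₚ.≤-trans |¬Rows|≤j j≤r)))
        (proj₁ (τ-sorts c) c<j)
    where
    σ : Permutation′ m
    σ = proj₁ (sortingPermutation (not ∘ Rows))
    σ-sorts : Sorts (not ∘ Rows) (count (not ∘ Rows)) σ
    σ-sorts = proj₂ (sortingPermutation (not ∘ Rows))
    τ : Permutation′ m
    τ = proj₁ (sortingPermutation Cols)
    τ-sorts : Sorts Cols (count Cols) τ
    τ-sorts = proj₂ (sortingPermutation Cols)
    |¬Rows|≤j : count (not ∘ Rows) ℕ.≤ count Cols
    |¬Rows|≤j = ℕₚ.+-cancelˡ-≤ (count Rows) _ _
      (subst (ℕ._≤ count Rows ℕ.+ count Cols) (sym (count+count-not Rows)) m≤r+j)

  count<m : ∀ {m} (S : Fin m → Bool) {i} → S i ≡ false → count S ℕ.< m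
  count<m S Sᵢ≡false = subst (count S ℕ.<_) (count+count-not S)
    (ℕₚ.m<m+n (count S) (count>0 (not ∘ S) (cong not Sᵢ≡false)))

  covering-counts : ∀ {a a′ b b′ m} → a ℕ.+ a′ ≡ m → b ℕ.+ b′ ≡ m →
                    a′ ℕ.+ b ℕ.< m → m ℕ.≤ a ℕ.+ b′
  covering-counts {a} {a′} {b} {b′} {m} a+a′≡m b+b′≡m a′+b<m =
    ℕₚ.≮⇒≥ λ a+b′<m → ℕₚ.<-irrefl total (ℕₚ.+-mono-< a+b′<m a′+b<m)
    where
    total : (a ℕ.+ b′) ℕ.+ (a′ ℕ.+ b) ≡ m ℕ.+ m
    total = trans (interchange a b′ a′ b) (cong₂ ℕ._+_ a+a′≡m (trans (ℕₚ.+-comm b′ b) b+b′≡m))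

  module _ {m} (A : Mat01 m m) (C : Fin m → Bool)
           (separated : ∀ r c d → C c ≡ true → C d ≡ false → A r c ≡ true → A r d ≡ false) where

    private
      meets? : ∀ r → Dec (∃ λ c → C c ≡ true × A r c ≡ true)
      meets? r = Finₚ.any? (λ c → (C c Bool.≟ true) ×-dec (A r c Bool.≟ true))

      meets : Fin m → Bool
      meets r = does (meets? r)

      missing-C-zero : ∀ r c → not (meets r) ≡ true → C c ≡ true → A r c ≡ false
      missing-C-zero r c r∉ c∈C with meets? r
      ... | no ¬meets = ¬-not (λ Aᵣ꜀≡true → ¬meets (c , c∈C , Aᵣ꜀≡true))

      meeting-C-zero : ∀ r d → meets r ≡ true → not (C d) ≡ true → A r d ≡ false
      meeting-C-zero r d r∈ d∉C with meets? r
      ... | yes (c , c∈C , Aᵣ꜀≡true) = separated r c d c∈C (not-injective d∉C) Aᵣ꜀≡true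

    separated⇒partlyDecomposable : ∀ {c d} → C c ≡ true → C d ≡ false → PartlyDecomposable A
    separated⇒partlyDecomposable {c} {d} c∈C d∉C with m ℕₚ.≤? count (not ∘ meets) ℕ.+ count C
    ... | yes m≤ = zeroBlock⇒partlyDecomposable A (not ∘ meets) C missing-C-zero
                     (count>0 C c∈C) (count<m C d∉C) m≤
    ... | no  m≰ = zeroBlock⇒partlyDecomposable A meets (not ∘ C) meeting-C-zero
                     (count>0 (not ∘ C) (cong not d∉C)) (count<m (not ∘ C) (cong not c∈C))
                     (covering-counts {a = count meets} {b = count C}
                        (count+count-not meets) (count+count-not C) (ℕₚ.≰⇒> m≰))

  -- The block matrix [N R; 0 A]

  module Block {k m} (N : Mat01 k k) (R : Mat01 k m) (A : Mat01 m m) where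

    P : Mat01 (k ℕ.+ m) (k ℕ.+ m)
    P = block N R A

    top : Fin k → Fin (k ℕ.+ m)
    top a = a ↑ˡ m

    bot : Fin m → Fin (k ℕ.+ m)
    bot c = k ↑ʳ c

    ι : Fin (suc k) → Fin (suc (k ℕ.+ m))
    ι zero    = zero
    ι (suc a) = suc (top a)

    top≢bot : ∀ {a c} → top a ≢ bot c
    top≢bot {a} {c} topa≡botc
      with trans (sym (Finₚ.splitAt-↑ˡ k a m)) (trans (cong (splitAt k) topa≡botc) (Finₚ.splitAt-↑ʳ k m c))
    ... | ()

    ι-injective : ∀ {b b′} → ι b ≡ ι b′ → b ≡ b′
    ι-injective {zero}  {zero}   _  = refl
    ι-injective {suc a} {suc a′} eq = cong suc (Finₚ.↑ˡ-injective m a a′ (Finₚ.suc-injective eq))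

    ι≢suc-bot : ∀ {b c} → ι b ≢ suc (bot c)
    ι≢suc-bot {suc a} eq = top≢bot (Finₚ.suc-injective eq)

    ↑-elim : ∀ {ℓ} (Q : Fin (k ℕ.+ m) → Set ℓ) →
             (∀ a → Q (top a)) → (∀ c → Q (bot c)) → ∀ r → Q r
    ↑-elim Q Q-top Q-bot r with splitAt k r in split≡
    ... | inj₁ a = subst Q (Finₚ.splitAt⁻¹-↑ˡ split≡) (Q-top a)
    ... | inj₂ c = subst Q (Finₚ.splitAt⁻¹-↑ʳ split≡) (Q-bot c)

    vertex-elim : ∀ {ℓ} (Q : Fin (suc (k ℕ.+ m)) → Set ℓ) →
                  (∀ b → Q (ι b)) → (∀ c → Q (suc (bot c))) → ∀ a → Q a
    vertex-elim Q Q-ι Q-bot zero    = Q-ι zero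
    vertex-elim Q Q-ι Q-bot (suc j) = ↑-elim (Q ∘ suc) (Q-ι ∘ suc) Q-bot j

    column-top : ∀ a r → column P (top a) r ≡ (column N a ++ 0ᵥ) r
    column-top a r rewrite Finₚ.splitAt-↑ˡ k a m with splitAt k r
    ... | inj₁ i = refl
    ... | inj₂ e = refl

    column-bot : ∀ c r → column P (bot c) r ≡ (column R c ++ column A c) r
    column-bot c r rewrite Finₚ.splitAt-↑ʳ k m c with splitAt k r
    ... | inj₁ i = refl
    ... | inj₂ e = refl

    vertex-ι : ∀ b r → vertex P (ι b) r ≡ (vertex N b ++ 0ᵥ) r
    vertex-ι zero    r with splitAt k r
    ... | inj₁ i = refl
    ... | inj₂ e = refl
    vertex-ι (suc a) r = column-top a r

    dot-++-vertex-ι : ∀ u x b → dot (u ++ x) (vertex P (ι b)) ≡ dot u (vertex N b)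
    dot-++-vertex-ι u x b = begin
      dot (u ++ x) (vertex P (ι b))            ≡⟨ dot-congʳ (u ++ x) (vertex-ι b) ⟩
      dot (u ++ x) (vertex N b ++ 0ᵥ)          ≡⟨ dot-++ u (vertex N b) x 0ᵥ ⟩
      dot u (vertex N b) + dot x 0ᵥ            ≡⟨ cong (dot u (vertex N b) +_) (dot-zeroʳ x) ⟩
      dot u (vertex N b) + 0ℚ                  ≡⟨ ℚₚ.+-identityʳ _ ⟩
      dot u (vertex N b)                       ∎
      where open ≡-Reasoning

    dot-++-column-bot : ∀ u x c → dot (u ++ x) (column P (bot c)) ≡ dot u (column R c) + dot x (column A c)
    dot-++-column-bot u x c = trans (dot-congʳ (u ++ x) (column-bot c)) (dot-++ u (column R c) x (column A c))

    mulVec-top : ∀ x i → mulVec P x (top i) ≡ mulVec N (x ∘ top) i + mulVec R (x ∘ bot) i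
    mulVec-top x i = trans (sum-++ k _) (cong₂ _+_
      (sum-cong (λ a → cong (_* x (top a)) (trans (column-top a (top i)) (lookup-++ˡ (column N a) 0ᵥ i))))
      (sum-cong (λ c → cong (_* x (bot c)) (trans (column-bot c (top i)) (lookup-++ˡ (column R c) (column A c) i)))))

    mulVec-bot : ∀ x e → mulVec P x (bot e) ≡ mulVec A (x ∘ bot) e
    mulVec-bot x e = begin
      mulVec P x (bot e)
        ≡⟨ sum-++ k _ ⟩
      sumℚ (λ a → column P (top a) (bot e) * x (top a)) + sumℚ (λ c → column P (bot c) (bot e) * x (bot c))
        ≡⟨ cong₂ _+_
             (sum-zero (λ a → trans (cong (_* x (top a)) (trans (column-top a (bot e)) (lookup-++ʳ (column N a) 0ᵥ e)))
                                    (ℚₚ.*-zeroˡ (x (top a)))))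
             (sum-cong (λ c → cong (_* x (bot c))
                                   (trans (column-bot c (bot e)) (lookup-++ʳ (column R c) (column A c) e)))) ⟩
      0ℚ + mulVec A (x ∘ bot) e
        ≡⟨ ℚₚ.+-identityˡ _ ⟩
      mulVec A (x ∘ bot) e ∎
      where open ≡-Reasoning

    nonsingular-N : Nonsingular P → Nonsingular N
    nonsingular-N ns z Nz≡0 a = trans (sym (lookup-++ˡ z 0ᵥ a)) (ns (z ++ 0ᵥ) P[z++0]≡0 (top a))
      where
      P[z++0]≡0 : ∀ r → mulVec P (z ++ 0ᵥ) r ≡ 0ℚ
      P[z++0]≡0 = ↑-elim _
        (λ i → trans (mulVec-top (z ++ 0ᵥ) i)
          (trans (cong₂ _+_ (trans (mulVec-cong N (lookup-++ˡ z 0ᵥ) i) (Nz≡0 i))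
                            (trans (mulVec-cong R (lookup-++ʳ z 0ᵥ) i) (mulVec-zero R i)))
                 (ℚₚ.+-identityʳ 0ℚ)))
        (λ e → trans (mulVec-bot (z ++ 0ᵥ) e) (trans (mulVec-cong A (lookup-++ʳ z 0ᵥ) e) (mulVec-zero A e)))

    nonsingular-A : Nonsingular P → Nonsingular A
    nonsingular-A ns = nonsingular-ᵀ (A ᵀ) Aᵀ-nonsingular
      where
      Aᵀ-nonsingular : Nonsingular (A ᵀ)
      Aᵀ-nonsingular y Aᵀy≡0 c =
        trans (sym (lookup-++ʳ (0ᵥ {k}) y c)) (nonsingular-ᵀ P ns (0ᵥ {k} ++ y) Pᵀ[0++y]≡0 (bot c))
        where
        Pᵀ[0++y]≡0 : ∀ j → dot (column P j) (0ᵥ {k} ++ y) ≡ 0ℚ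
        Pᵀ[0++y]≡0 = ↑-elim _
          (λ a → trans (dot-comm _ (0ᵥ {k} ++ y))
                   (trans (dot-++-vertex-ι (0ᵥ {k}) y (suc a)) (dot-zeroˡ (column N a))))
          (λ c → trans (dot-comm _ (0ᵥ {k} ++ y)) (trans (dot-++-column-bot (0ᵥ {k}) y c)
                   (trans (cong₂ _+_ (dot-zeroˡ (column R c)) (trans (dot-comm y (column A c)) (Aᵀy≡0 c)))
                          (ℚₚ.+-identityʳ 0ℚ))))

    module ColumnsOfR (ns : Nonsingular P) (nonobtuse : NonobtuseSimplex P) where
      open DualBasis P ns

      K : Matℚ m m
      K c e = dot (column A c) (column A e)

      K≥0 : ∀ c e → 0ℚ ≤ K c e
      K≥0 c e = sum-nonNeg (λ r → *-nonNeg (0≤toℚ (A r c)) (0≤toℚ (A r e)))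

      Rcol : Fin m → Vecℚ (k ℕ.+ m)
      Rcol c = column R c ++ 0ᵥ

      Acol : Fin m → Vecℚ (k ℕ.+ m)
      Acol c = 0ᵥ {k} ++ column A c

      Rcol≗column-Acol : ∀ c r → Rcol c r ≡ (column P (bot c) −v Acol c) r
      Rcol≗column-Acol c = ↑-elim _
        (λ i → trans (lookup-++ˡ (column R c) 0ᵥ i) (sym (trans
          (cong₂ _-_ (trans (column-bot c (top i)) (lookup-++ˡ (column R c) (column A c) i))
                     (lookup-++ˡ (0ᵥ {k}) (column A c) i))
          (ℚₚ.+-identityʳ _))))
        (λ e → trans (lookup-++ʳ (column R c) 0ᵥ e) (sym (trans
          (cong₂ _-_ (trans (column-bot c (bot e)) (lookup-++ʳ (column R c) (column A c) e))
                     (lookup-++ʳ (0ᵥ {k}) (column A c) e))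
          (ℚₚ.+-inverseʳ (column A c e)))))

      dot-Rcol : ∀ w c → dot w (Rcol c) ≡ dot w (column P (bot c)) - dot w (Acol c)
      dot-Rcol w c = trans (dot-congʳ w (Rcol≗column-Acol c)) (dot-−v w _ _)

      dot-Acol : ∀ w c → dot w (Acol c) ≡ sumℚ (λ e → K e c * dot w (q (bot e)))
      dot-Acol w c = begin
        dot w (Acol c)
          ≡⟨ expansion (Acol c) w ⟩
        sumℚ (λ j → dot (column P j) (Acol c) * dot w (q j))
          ≡⟨ sum-++ k _ ⟩
        sumℚ (λ a → dot (column P (top a)) (Acol c) * dot w (q (top a))) +
        sumℚ (λ e → dot (column P (bot e)) (Acol c) * dot w (q (bot e)))
          ≡⟨ cong₂ _+_ (sum-zero (λ a → trans (cong (_* dot w (q (top a))) (column-top·Acol a))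
                                              (ℚₚ.*-zeroˡ (dot w (q (top a))))))
                       (sum-cong (λ e → cong (_* dot w (q (bot e))) (column-bot·Acol e))) ⟩
        0ℚ + sumℚ (λ e → K e c * dot w (q (bot e)))
          ≡⟨ ℚₚ.+-identityˡ _ ⟩
        sumℚ (λ e → K e c * dot w (q (bot e))) ∎
        where
        open ≡-Reasoning
        column-top·Acol : ∀ a → dot (column P (top a)) (Acol c) ≡ 0ℚ
        column-top·Acol a = trans (dot-comm _ (Acol c))
          (trans (dot-++-vertex-ι (0ᵥ {k}) (column A c) (suc a)) (dot-zeroˡ (column N a)))
        column-bot·Acol : ∀ e → dot (column P (bot e)) (Acol c) ≡ K e c
        column-bot·Acol e = trans (dot-comm _ (Acol c)) (trans (dot-++-column-bot (0ᵥ {k}) (column A c) e)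
          (trans (cong₂ _+_ (dot-zeroˡ (column R e)) (dot-comm (column A c) (column A e))) (ℚₚ.+-identityˡ _)))

      μ : Fin m → Vecℚ (k ℕ.+ m)
      μ c = proj₁ (nonsingular⇒surjective P ns (Rcol c))

      Pμ≡Rcol : ∀ c r → mulVec P (μ c) r ≡ Rcol c r
      Pμ≡Rcol c = proj₂ (nonsingular⇒surjective P ns (Rcol c))

      μ-bot≡0 : ∀ c e → μ c (bot e) ≡ 0ℚ
      μ-bot≡0 c = nonsingular-A ns (μ c ∘ bot) (λ e →
        trans (sym (mulVec-bot (μ c) e)) (trans (Pμ≡Rcol c (bot e)) (lookup-++ʳ (column R c) 0ᵥ e)))

      μ-top≥0 : ∀ c a → 0ℚ ≤ μ c (top a)
      μ-top≥0 c a = begin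
        0ℚ                                                              ≤⟨ ℚₚ.neg-antimono-≤ X≤0 ⟩
        - X                                                             ≡⟨ ℚₚ.+-identityˡ (- X) ⟨
        0ℚ - X                                                          ≡⟨ q·column-q·Acol ⟨
        dot (q (top a)) (column P (bot c)) - dot (q (top a)) (Acol c)   ≡⟨ dot-Rcol (q (top a)) c ⟨
        dot (q (top a)) (Rcol c)                                        ≡⟨ coordinates (Pμ≡Rcol c) (top a) ⟨
        μ c (top a)                                                     ∎
        where
        open ℚ-≤-Reasoning
        X : ℚ
        X = sumℚ (λ e → K e c * dot (q (top a)) (q (bot e)))
        X≤0 : X ≤ 0ℚ
        X≤0 = sum-nonPos (λ e → *-nonNeg-nonPos (K≥0 e c) (q·q≤0 nonobtuse (top a) (bot e) top≢bot))
        q·column-q·Acol : dot (q (top a)) (column P (bot c)) - dot (q (top a)) (Acol c) ≡ 0ℚ - X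
        q·column-q·Acol = cong₂ _-_ (trans (q-column (top a) (bot c)) (δ-≢ (top≢bot {a} {c})))
                                    (dot-Acol (q (top a)) c)

      Σμ-top≤1 : ∀ c → sumℚ (μ c ∘ top) ≤ 1ℚ
      Σμ-top≤1 c = begin
        sumℚ (μ c ∘ top)                            ≡⟨ ℚₚ.+-identityʳ _ ⟨
        sumℚ (μ c ∘ top) + 0ℚ                       ≡⟨ cong (sumℚ (μ c ∘ top) +_) (sum-zero (μ-bot≡0 c)) ⟨
        sumℚ (μ c ∘ top) + sumℚ (μ c ∘ bot)         ≡⟨ sum-++ k (μ c) ⟨
        sumℚ (μ c)                                  ≡⟨ sum-cong (λ j → trans (sym (ℚₚ.*-identityʳ (μ c j)))
                                                                            (cong (μ c j *_) (sym (s-column j)))) ⟩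
        sumℚ (λ j → μ c j * dot s (column P j))     ≡⟨ dot-mulVec s P (μ c) ⟨
        dot s (mulVec P (μ c))                      ≡⟨ dot-congʳ s (Pμ≡Rcol c) ⟩
        dot s (Rcol c)                              ≡⟨ dot-Rcol s c ⟩
        dot s (column P (bot c)) - dot s (Acol c)   ≡⟨ cong₂ _-_ (s-column (bot c)) (dot-Acol s c) ⟩
        1ℚ - Y                                      ≤⟨ 0≤x⇒y-x≤y 1ℚ Y≥0 ⟩
        1ℚ                                          ∎
        where
        open ℚ-≤-Reasoning
        Y : ℚ
        Y = sumℚ (λ e → K e c * dot s (q (bot e)))
        Y≥0 : 0ℚ ≤ Y
        Y≥0 = sum-nonNeg (λ e →
          *-nonNeg (K≥0 e c) (subst (0ℚ ≤_) (dot-comm (q (bot e)) s) (0≤q·s nonobtuse (bot e))))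

      R≡Nμ : ∀ c i → toℚ (R i c) ≡ mulVec N (μ c ∘ top) i
      R≡Nμ c i = begin
        toℚ (R i c)                                       ≡⟨ lookup-++ˡ (column R c) 0ᵥ i ⟨
        Rcol c (top i)                                    ≡⟨ Pμ≡Rcol c (top i) ⟨
        mulVec P (μ c) (top i)                            ≡⟨ mulVec-top (μ c) i ⟩
        mulVec N (μ c ∘ top) i + mulVec R (μ c ∘ bot) i   ≡⟨ cong (mulVec N (μ c ∘ top) i +_)
                                                                (trans (mulVec-cong R (μ-bot≡0 c) i) (mulVec-zero R i)) ⟩
        mulVec N (μ c ∘ top) i + 0ℚ                       ≡⟨ ℚₚ.+-identityʳ _ ⟩
        mulVec N (μ c ∘ top) i                            ∎
        where open ≡-Reasoning

      column-R-vertex : ∀ c → ∃ λ σ → ∀ i → toℚ (R i c) ≡ vertex N σ i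
      column-R-vertex c = zero⊎column⇒vertex N (λ i → R i c)
        (zeroOne-subconvex⇒zero⊎column N (λ i → R i c) (μ c ∘ top) (μ-top≥0 c) (Σμ-top≤1 c) (R≡Nμ c))

      σ : Fin m → Fin (suc k)
      σ c = proj₁ (column-R-vertex c)

      q·Rcol : ∀ j c → dot (q j) (Rcol c) ≡ δ (suc j) (ι (σ c))
      q·Rcol j c = trans (dot-congʳ (q j) Rcol≗vertex) (q-vertex j (ι (σ c)))
        where
        Rcol≗vertex : ∀ r → Rcol c r ≡ vertex P (ι (σ c)) r
        Rcol≗vertex r = trans (++-cong (column R c) (vertex N (σ c)) (proj₂ (column-R-vertex c)) (λ _ → refl) r)
                              (sym (vertex-ι (σ c) r))

      q·Acol : ∀ j c → dot (q j) (Acol c) ≡ δ j (bot c) - δ (suc j) (ι (σ c))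
      q·Acol j c = begin
        a                    ≡⟨ solve 2 (λ a b → a := b :+ :- (b :+ :- a)) refl a b ⟩
        b - (b - a)          ≡⟨ cong₂ _-_ (q-column j (bot c)) (sym (dot-Rcol (q j) c)) ⟩
        δ j (bot c) - dot (q j) (Rcol c)
                             ≡⟨ cong (λ t → δ j (bot c) - t) (q·Rcol j c) ⟩
        δ j (bot c) - δ (suc j) (ι (σ c)) ∎
        where
        open ≡-Reasoning
        a b : ℚ
        a = dot (q j) (Acol c)
        b = dot (q j) (column P (bot c))

      W : Matℚ m m
      W d e = dot (q (bot d)) (q (bot e))

      KW≡I : ∀ c d → (K ·ₘ W) c d ≡ δ c d
      KW≡I c d = begin
        sumℚ (λ e → K c e * W e d)
          ≡⟨ sum-cong (λ e → cong₂ _*_ (dot-comm (column A c) (column A e)) (dot-comm (q (bot e)) (q (bot d)))) ⟩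
        sumℚ (λ e → K e c * dot (q (bot d)) (q (bot e)))
          ≡⟨ dot-Acol (q (bot d)) c ⟨
        dot (q (bot d)) (Acol c)
          ≡⟨ q·Acol (bot d) c ⟩
        δ (bot d) (bot c) - δ (suc (bot d)) (ι (σ c))
          ≡⟨ cong₂ _-_ (δ-injective bot (Finₚ.↑ʳ-injective k _ _) d c)
                       (δ-≢ {i = suc (bot d)} {ι (σ c)} (ι≢suc-bot ∘ sym)) ⟩
        δ d c - 0ℚ
          ≡⟨ ℚₚ.+-identityʳ (δ d c) ⟩
        δ d c
          ≡⟨ δ-sym d c ⟩
        δ c d ∎
        where open ≡-Reasoning

      C : Fin k → Fin m → Bool
      C a c = does (suc a Fin.≟ σ c)

      g : Fin k → Vecℚ m
      g a e = dot (q (top a)) (q (bot e))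

      Kg≡-C : ∀ a c → apply K (g a) c ≡ - toℚ (C a c)
      Kg≡-C a c = begin
        sumℚ (λ e → K c e * g a e)
          ≡⟨ sum-cong (λ e → cong (_* g a e) (dot-comm (column A c) (column A e))) ⟩
        sumℚ (λ e → K e c * dot (q (top a)) (q (bot e)))
          ≡⟨ dot-Acol (q (top a)) c ⟨
        dot (q (top a)) (Acol c)
          ≡⟨ q·Acol (top a) c ⟩
        δ (top a) (bot c) - δ (ι (suc a)) (ι (σ c))
          ≡⟨ cong₂ _-_ (δ-≢ (top≢bot {a} {c})) (δ-injective ι ι-injective (suc a) (σ c)) ⟩
        0ℚ - δ (suc a) (σ c)
          ≡⟨ ℚₚ.+-identityˡ _ ⟩
        - toℚ (C a c) ∎
        where open ≡-Reasoning

      A-separated : ∀ a r c d → C a c ≡ true → C a d ≡ false → A r c ≡ true → A r d ≡ false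
      A-separated a r c d c∈Cₐ d∉Cₐ = gram≡0⇒disjoint A c d
        (K-separates K W (λ c e → dot-comm (column A c) (column A e))
                         (λ d e → dot-comm (q (bot d)) (q (bot e))) KW≡I
           (λ d e d≢e → q·q≤0 nonobtuse (bot d) (bot e) (d≢e ∘ Finₚ.↑ʳ-injective k d e))
           (C a) (g a) (λ e → q·q≤0 nonobtuse (top a) (bot e) top≢bot) (Kg≡-C a) c d c∈Cₐ d∉Cₐ) r

      module _ (fully-indecomposable : FullyIndecomposable A) where

        σ-stable : ∀ a c c′ → σ c ≡ suc a → σ c′ ≡ suc a
        σ-stable a c c′ σc≡a = sym (decidable-stable (suc a Fin.≟ σ c′) λ a≢σc′ →
          fully-indecomposable (separated⇒partlyDecomposable A (C a) (A-separated a)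
            (dec-true (suc a Fin.≟ σ c) (sym σc≡a)) (dec-false (suc a Fin.≟ σ c′) a≢σc′)))

        σ-constant : ∀ c c′ → σ c ≡ σ c′
        σ-constant c c′ = agree (σ c) (σ c′) refl refl
          where
          agree : ∀ b b′ → σ c ≡ b → σ c′ ≡ b′ → b ≡ b′
          agree zero    zero    _     _     = refl
          agree (suc a) _       σc≡a  σc′≡b = trans (sym (σ-stable a c c′ σc≡a)) σc′≡b
          agree zero    (suc a) σc≡0  σc′≡a =
            contradiction (trans (sym σc≡0) (σ-stable a c′ c σc′≡a)) λ ()

    module _ (ns : Nonsingular P) (nonobtuse : NonobtuseSimplex P)
             (σ : Fin (suc k)) (R≡vertex : ∀ i c → toℚ (R i c) ≡ vertex N σ i) where

      dot-++-vertex-bot : ∀ u x c → dot (u ++ x) (vertex P (suc (bot c))) ≡ dot u (vertex N σ) + dot x (column A c)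
      dot-++-vertex-bot u x c =
        trans (dot-++-column-bot u x c) (cong (_+ dot x (column A c)) (dot-congʳ u (λ i → R≡vertex i c)))

      nonobtuse-N : 1 ℕ.≤ k → NonobtuseSimplex N
      nonobtuse-N 1≤k = nonsingular-N ns , angles
        where
        open DualBasis A (nonsingular-A ns) using () renaming (s to ζ; s-column to ζ-column)

        offset : Vecℚ k → ℚ → ℚ
        offset u κ = κ - dot u (vertex N σ)

        lift : Vecℚ k → ℚ → Vecℚ (k ℕ.+ m)
        lift u κ = u ++ (λ r → offset u κ * ζ r)

        lift-facetNormal : ∀ {i u κ} → FacetNormal N i u κ → FacetNormal P (ι i) (lift u κ) κ
        lift-facetNormal {i} {u} {κ} (facetNormal on-facet beyond) =
          facetNormal (vertex-elim _ on-ι on-bot) (subst (κ <_) (sym (dot-++-vertex-ι u _ i)) beyond)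
          where
          on-ι : ∀ b → ι b ≢ ι i → dot (lift u κ) (vertex P (ι b)) ≡ κ
          on-ι b ιb≢ιi = trans (dot-++-vertex-ι u _ b) (on-facet b (ιb≢ιi ∘ cong ι))
          on-bot : ∀ c → suc (bot c) ≢ ι i → dot (lift u κ) (vertex P (suc (bot c))) ≡ κ
          on-bot c _ = begin
            dot (lift u κ) (vertex P (suc (bot c)))
              ≡⟨ dot-++-vertex-bot u _ c ⟩
            dot u (vertex N σ) + dot (λ r → offset u κ * ζ r) (column A c)
              ≡⟨ cong (dot u (vertex N σ) +_)
                      (trans (dot-*ˡ (offset u κ) ζ (column A c)) (cong (offset u κ *_) (ζ-column c))) ⟩
            dot u (vertex N σ) + offset u κ * 1ℚ
              ≡⟨ solve 2 (λ x y → x :+ (y :+ :- x) :* con 1ℚ := y) refl (dot u (vertex N σ)) κ ⟩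
            κ ∎
            where open ≡-Reasoning

        offset≡0 : ∀ {i u κ} → FacetNormal N i u κ → σ ≢ i → offset u κ ≡ 0ℚ
        offset≡0 {κ = κ} u-normal σ≢i =
          trans (cong (λ t → κ - t) (FacetNormal.on-facet u-normal σ σ≢i)) (ℚₚ.+-inverseʳ κ)

        lift·lift : ∀ {i j u w κ κ′} → i ≢ j → FacetNormal N i u κ → FacetNormal N j w κ′ →
                    dot (lift u κ) (lift w κ′) ≡ dot u w
        lift·lift {i} {j} {u} {w} {κ} {κ′} i≢j u-normal w-normal =
          trans (dot-++ u w _ _) (trans (cong (dot u w +_) tails⊥) (ℚₚ.+-identityʳ (dot u w)))
          where
          tails⊥ : dot (λ r → offset u κ * ζ r) (λ r → offset w κ′ * ζ r) ≡ 0ℚ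
          tails⊥ = by-cases (σ Fin.≟ i)
            where
            by-cases : Dec (σ ≡ i) → dot (λ r → offset u κ * ζ r) (λ r → offset w κ′ * ζ r) ≡ 0ℚ
            by-cases (no σ≢i)  = dot-scaled-zero ζ _ (offset≡0 u-normal σ≢i)
            by-cases (yes σ≡i) = trans (dot-comm (λ r → offset u κ * ζ r) _)
              (dot-scaled-zero ζ (λ r → offset u κ * ζ r) (offset≡0 w-normal (i≢j ∘ trans (sym σ≡i))))

        angles : ∀ i j → i ≢ j → ∀ u w → InwardNormal N i u → InwardNormal N j w → dot u w ≤ 0ℚ
        angles i j i≢j u w u-inward w-inward =
          let (_ , u-normal) = inwardNormal⇒facetNormal′ {M = N} {u = u} 1≤k u-inward
              (_ , w-normal) = inwardNormal⇒facetNormal′ {M = N} {u = w} 1≤k w-inward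
          in subst (_≤ 0ℚ) (lift·lift i≢j u-normal w-normal)
               (nonobtuse-facetNormals nonobtuse (i≢j ∘ ι-injective)
                  (lift-facetNormal u-normal) (lift-facetNormal w-normal))

      nonobtuse-A : 1 ℕ.≤ m → NonobtuseSimplex A
      nonobtuse-A 1≤m = nonsingular-A ns , angles
        where
        open DualBasis N (nonsingular-N ns) using (normal; level; normal-facet; normal-vertex)

        facet : Fin (suc m) → Fin (suc (k ℕ.+ m))
        facet zero    = ι σ
        facet (suc c) = suc (bot c)

        facet-injective : ∀ {i j} → facet i ≡ facet j → i ≡ j
        facet-injective {zero}  {zero}  _  = refl
        facet-injective {zero}  {suc d} eq = contradiction eq ι≢suc-bot
        facet-injective {suc c} {zero}  eq = contradiction (sym eq) ι≢suc-bot
        facet-injective {suc c} {suc d} eq = cong suc (Finₚ.↑ʳ-injective k c d (Finₚ.suc-injective eq))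

        head : Fin (suc m) → ℚ → Vecℚ k
        head zero    κ r = - κ * normal σ r
        head (suc c) κ   = 0ᵥ

        head⊥head : ∀ {i j} κ κ′ → i ≢ j → dot (head i κ) (head j κ′) ≡ 0ℚ
        head⊥head {zero}  {zero}  κ κ′ 0≢0 = contradiction refl 0≢0
        head⊥head {zero}  {suc d} κ κ′ _   = dot-zeroʳ (head zero κ)
        head⊥head {suc c} {j}     κ κ′ _   = dot-zeroˡ (head j κ′)

        lift-facetNormal : ∀ {i u κ} → FacetNormal A i u κ →
                           ∃ λ κ′ → FacetNormal P (facet i) (head i κ ++ u) κ′
        lift-facetNormal {suc c} {u} {κ} (facetNormal on-facet beyond) =
          κ , facetNormal (vertex-elim _ on-ι on-bot)
                          (subst (κ <_) (sym (trans (dot-++-vertex-bot 0ᵥ u c)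
                                                    (trans (cong (_+ _) (dot-zeroˡ (vertex N σ))) (ℚₚ.+-identityˡ _))))
                                 beyond)
          where
          on-ι : ∀ b → ι b ≢ suc (bot c) → dot (0ᵥ ++ u) (vertex P (ι b)) ≡ κ
          on-ι b _ = trans (dot-++-vertex-ι 0ᵥ u b)
            (trans (dot-zeroˡ (vertex N b)) (trans (sym (dot-zeroʳ u)) (on-facet zero λ ())))
          on-bot : ∀ d → suc (bot d) ≢ suc (bot c) → dot (0ᵥ ++ u) (vertex P (suc (bot d))) ≡ κ
          on-bot d d≢c = trans (dot-++-vertex-bot 0ᵥ u d)
            (trans (cong₂ _+_ (dot-zeroˡ (vertex N σ))
                              (on-facet (suc d) (d≢c ∘ cong (suc ∘ bot) ∘ Finₚ.suc-injective)))
                   (ℚₚ.+-identityˡ κ))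
        lift-facetNormal {zero} {u} {κ} (facetNormal on-facet beyond) =
          - κ * level σ , facetNormal (vertex-elim _ on-ι on-bot) beyond′
          where
          x : Vecℚ k
          x = head zero κ
          x·vertex : ∀ b → dot x (vertex N b) ≡ - κ * dot (normal σ) (vertex N b)
          x·vertex b = dot-*ˡ (- κ) (normal σ) (vertex N b)
          0<-κ : 0ℚ < - κ
          0<-κ = ℚₚ.neg-antimono-< (subst (κ <_) (dot-zeroʳ u) beyond)
          on-ι : ∀ b → ι b ≢ ι σ → dot (x ++ u) (vertex P (ι b)) ≡ - κ * level σ
          on-ι b ιb≢ισ = trans (dot-++-vertex-ι x u b)
            (trans (x·vertex b) (cong (- κ *_) (normal-facet σ b (ιb≢ισ ∘ cong ι))))
          on-bot : ∀ c → suc (bot c) ≢ ι σ → dot (x ++ u) (vertex P (suc (bot c))) ≡ - κ * level σ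
          on-bot c _ = begin
            dot (x ++ u) (vertex P (suc (bot c)))          ≡⟨ dot-++-vertex-bot x u c ⟩
            dot x (vertex N σ) + dot u (column A c)
              ≡⟨ cong₂ _+_ (trans (x·vertex σ) (cong (- κ *_) (normal-vertex σ))) (on-facet (suc c) λ ()) ⟩
            - κ * (level σ + 1ℚ) + κ
              ≡⟨ solve 2 (λ y l → :- y :* (l :+ con 1ℚ) :+ y := :- y :* l) refl κ (level σ) ⟩
            - κ * level σ ∎
            where open ≡-Reasoning
          beyond′ : - κ * level σ < dot (x ++ u) (vertex P (ι σ))
          beyond′ = begin-strict
            - κ * level σ                  ≡⟨ ℚₚ.+-identityʳ _ ⟨
            - κ * level σ + 0ℚ             <⟨ ℚₚ.+-monoʳ-< (- κ * level σ) 0<-κ ⟩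
            - κ * level σ + - κ            ≡⟨ solve 2 (λ y l → :- y :* l :+ :- y := :- y :* (l :+ con 1ℚ))
                                                       refl κ (level σ) ⟩
            - κ * (level σ + 1ℚ)           ≡⟨ cong (- κ *_) (normal-vertex σ) ⟨
            - κ * dot (normal σ) (vertex N σ) ≡⟨ x·vertex σ ⟨
            dot x (vertex N σ)             ≡⟨ dot-++-vertex-ι x u σ ⟨
            dot (x ++ u) (vertex P (ι σ))  ∎
            where open ℚ-≤-Reasoning

        angles : ∀ i j → i ≢ j → ∀ u w → InwardNormal A i u → InwardNormal A j w → dot u w ≤ 0ℚ
        angles i j i≢j u w u-inward w-inward =
          let (κ  , u-normal) = inwardNormal⇒facetNormal′ {M = A} {u = u} 1≤m u-inward
              (κ′ , w-normal) = inwardNormal⇒facetNormal′ {M = A} {u = w} 1≤m w-inward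
          in subst (_≤ 0ℚ)
               (trans (dot-++ (head i κ) (head j κ′) u w)
                      (trans (cong (_+ dot u w) (head⊥head κ κ′ i≢j)) (ℚₚ.+-identityˡ (dot u w))))
               (nonobtuse-facetNormals nonobtuse (i≢j ∘ facet-injective)
                  (proj₂ (lift-facetNormal u-normal)) (proj₂ (lift-facetNormal w-normal)))

open NonobtuseBlocks using (module Block; vertex⇒zero⊎column; toℚ-injective)
open import Data.Bool using (Bool; false)
open import Data.Nat using (ℕ; suc; _≤_)
open import Data.Fin using (Fin; fromℕ<)
open import Data.Sum using (_⊎_)
open import Data.Product using (Σ; ∃; _×_; _,_; proj₂)
open import Relation.Binary.PropositionalEquality using (_≡_; trans; sym; cong)

theorem4p1 : (k m : ℕ) → 1 ≤ k → 1 ≤ m →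
    (N : Mat01 k k) (R : Mat01 k m) (A : Mat01 m m) →
    Nonsingular (block N R A) →
    FullyIndecomposable A →
    NonobtuseSimplex (block N R A) →
    NonobtuseSimplex N × NonobtuseSimplex A ×
    Σ (Fin k → Bool) (λ ν →
      ((∀ i → ν i ≡ false) ⊎ ∃ (λ j → ∀ i → ν i ≡ N i j)) ×
      (∀ i j → R i j ≡ ν i))
theorem4p1 k m 1≤k 1≤m N R A ns fully-indecomposable nonobtuse =
  nonobtuse-N ns nonobtuse σ₀ R≡vertex 1≤k ,
  nonobtuse-A ns nonobtuse σ₀ R≡vertex 1≤m ,
  (λ i → R i c₀) , vertex⇒zero⊎column N (λ i → R i c₀) σ₀ (λ i → R≡vertex i c₀) ,
  λ i c → toℚ-injective (trans (R≡vertex i c) (sym (R≡vertex i c₀)))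
  where
  open Block N R A
  open ColumnsOfR ns nonobtuse
  c₀ : Fin m
  c₀ = fromℕ< 1≤m
  σ₀ : Fin (suc k)
  σ₀ = σ c₀
  R≡vertex : ∀ i c → toℚ (R i c) ≡ vertex N σ₀ i
  R≡vertex i c = trans (proj₂ (column-R-vertex c) i)
                       (cong (λ b → vertex N b i) (σ-constant fully-indecomposable c c₀))
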